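{- A domain $D\subseteq\{0,1\}^n$ is a local possibility domain if and only if there is a local possibility integrity constraint $\phi$ such that the set of models of $\phi$ equals $D$.
   Context: Standing assumption: domains $D\subseteq\{0,1\}^n$ are non-degenerate, i.e. the projection of $D$ onto each coordinate is $\{0,1\}$. A $k$-ary aggregator for $D$ ($k\ge2$) is an $n$-tuple $(f_1,\ldots,f_n)$ of unanimous functions $f_j:\{0,1\}^k\to\{0,1\}$ such that whenever $x^1,\ldots,x^k\in D$, $(f_1(x^1_1,\ldots,x^k_1),\ldots,f_n(x^1_n,\ldots,x^k_n))\in D$. It is locally non-dictatorial if no $f_j$ equals a projection ${\rm pr}^k_d$. $D$ is a local possibility domain if it admits a locally non-dictatorial aggregator. Horn clause: at most one positive literal. Renaming a set $W$ of variables: swap $x$ and $\neg x$ for all $x\in W$. A formula over $V$ is partially Horn with admissible set $V_0\subseteq V$ (non-empty) if every clause containing only variables from $V_0$ is Horn and the variables of $V_0$ appear only negatively in clauses also containing variables outside $V_0$. For disjoint variable sets $V,V'$, a $(V,V')$-generalized clause is $(l_1\vee\cdots\vee l_s\vee(l_{s+1}\oplus\cdots\oplus l_t))$, $s<t$, with $l_1,\ldots,l_s$ literals of variables in $V$ and $l_{s+1},\ldots,l_t$ literals of variables in $V'$; it is falsified exactly by assignments falsifying all $l_i$, $i\le s$, and satisfying an even number of $l_{s+1},\ldots,l_t$. A formula $\phi$ over $V$ is a local possibility integrity constraint if there are pairwise disjoint $V_0,V_1,V_2\subseteq V$ with union $V$, such that no clause contains variables from both $V_1$ and $V_2$, and: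 (1) renaming some variables of $V_0$ yields a partially Horn formula with admissible set $V_0$; (2) every clause contains at most two variables from $V_1$; (3) the clauses containing variables from $V_2$ are $(V_0,V_2)$-generalized clauses. -}

module Defs where

open import Data.Nat using (ℕ; _≥_)
open import Data.Fin using (Fin)
open import Data.Bool using (Bool; true; false; not; _∨_; _xor_; if_then_else_)
open import Data.Vec using (Vec; lookup; replicate; tabulate; map)
open import Data.List using (List; []; _∷_; foldr)
open import Data.List.Membership.Propositional using (_∈_)
open import Data.Product using (Σ; _×_; ∃; ∃-syntax)
open import Data.Sum using (_⊎_)
open import Relation.Binary.PropositionalEquality using (_≡_; _≢_)
open import Relation.Nullary using (¬_)
open import Data.Empty using (⊥)

-- A domain D ⊆ {0,1}^n, given by its characteristic function
-- (0 = false, 1 = true).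
Domain : ℕ → Set
Domain n = Vec Bool n → Bool

_∈D_ : ∀ {n} → Vec Bool n → Domain n → Set
x ∈D D = D x ≡ true

NonDegenerate : ∀ {n} → Domain n → Set
NonDegenerate {n} D = (j : Fin n) (b : Bool) → ∃[ x ] (x ∈D D × lookup x j ≡ b)

Unanimous : ∀ {k} → (Vec Bool k → Bool) → Set
Unanimous {k} f = (b : Bool) → f (replicate k b) ≡ b

IsProjection : ∀ {k} → (Vec Bool k → Bool) → Fin k → Set
IsProjection f d = ∀ y → f y ≡ lookup y d

-- A k-ary aggregator (f_1,…,f_n) for D.
-- xs = (x^1,…,x^k); the j-th coordinate of the output is f_j(x^1_j,…,x^k_j).
IsAggregator : ∀ {n} (k : ℕ) → Domain n → (Fin n → Vec Bool k → Bool) → Set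
IsAggregator {n} k D f =
  ((j : Fin n) → Unanimous (f j)) ×
  ((xs : Vec (Vec Bool n) k) →
     ((i : Fin k) → lookup xs i ∈D D) →
     tabulate (λ j → f j (map (λ x → lookup x j) xs)) ∈D D)

LocallyNonDictatorial : ∀ {n k} → (Fin n → Vec Bool k → Bool) → Set
LocallyNonDictatorial {n} {k} f = (j : Fin n) (d : Fin k) → ¬ IsProjection (f j) d

LocalPossibilityDomain : ∀ {n} → Domain n → Set
LocalPossibilityDomain {n} D =
  ∃[ k ] (k ≥ 2 × Σ (Fin n → Vec Bool k → Bool) λ f →
            IsAggregator k D f × LocallyNonDictatorial f)

-- A literal over variables Fin n: positive (sign = true) or negative.
record Literal (n : ℕ) : Set where
  constructor lit
  field
    var  : Fin n
    sign : Bool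
open Literal public

-- A (generalized) clause  (l_1 ∨ … ∨ l_s ∨ (l_{s+1} ⊕ … ⊕ l_t)).
-- An ordinary clause has an empty xor-part.
record Clause (n : ℕ) : Set where
  constructor clause
  field
    disj : List (Literal n)
    par  : List (Literal n)
open Clause public

Formula : ℕ → Set
Formula n = List (Clause n)

evalLit : ∀ {n} → Vec Bool n → Literal n → Bool
evalLit a l = if sign l then lookup a (var l) else not (lookup a (var l))

anyTrue : List Bool → Bool
anyTrue = foldr _∨_ false

parity : List Bool → Bool
parity = foldr _xor_ false

evalLits : ∀ {n} → Vec Bool n → List (Literal n) → List Bool
evalLits a [] = []
evalLits a (l ∷ ls) = evalLit a l ∷ evalLits a ls

SatClause : ∀ {n} → Vec Bool n → Clause n → Set
SatClause a C = (anyTrue (evalLits a (disj C)) ∨ parity (evalLits a (par C))) ≡ true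

Model : ∀ {n} → Formula n → Vec Bool n → Set
Model φ a = ∀ {C} → C ∈ φ → SatClause a C

_∈L_ : ∀ {n} → Literal n → Clause n → Set
l ∈L C = l ∈ disj C ⊎ l ∈ par C

_occursIn_ : ∀ {n} → Fin n → Clause n → Set
v occursIn C = ∃[ l ] (l ∈L C × var l ≡ v)

data Part : Set where
  P0 P1 P2 : Part

module _ {n : ℕ} (part : Fin n → Part) where

  -- Renaming a set W ⊆ V of variables (W given by its characteristic function).
  renameLit : (Fin n → Bool) → Literal n → Literal n
  renameLit W l = lit (var l) (if W (var l) then not (sign l) else sign l)

  renameLits : (Fin n → Bool) → List (Literal n) → List (Literal n)
  renameLits W [] = []
  renameLits W (l ∷ ls) = renameLit W l ∷ renameLits W ls

  renameClause : (Fin n → Bool) → Clause n → Clause n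
  renameClause W C = clause (renameLits W (disj C)) (renameLits W (par C))

  Horn : Clause n → Set
  Horn C = ∀ {l l'} → l ∈L C → l' ∈L C → sign l ≡ true → sign l' ≡ true → l ≡ l'

  OnlyV0 : Clause n → Set
  OnlyV0 C = ∀ {l} → l ∈L C → part (var l) ≡ P0

  -- Partially Horn with admissible set V0 (the conditions other than
  -- non-emptiness of V0).
  PartiallyHorn : Formula n → Set
  PartiallyHorn ψ = ∀ {C} → C ∈ ψ →
    (OnlyV0 C → Horn C) ×
    (¬ OnlyV0 C → ∀ {l} → l ∈L C → part (var l) ≡ P0 → sign l ≡ false)

  renameFormula : (Fin n → Bool) → Formula n → Formula n
  renameFormula W [] = []
  renameFormula W (C ∷ ψ) = renameClause W C ∷ renameFormula W ψ

  Cond1 : Formula n → Set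
  Cond1 φ = Σ (Fin n → Bool) λ W →
    ((v : Fin n) → W v ≡ true → part v ≡ P0) × PartiallyHorn (renameFormula W φ)

  Cond2 : Formula n → Set
  Cond2 φ = ∀ {C} → C ∈ φ → ∀ {u v w} →
    u occursIn C → v occursIn C → w occursIn C →
    part u ≡ P1 → part v ≡ P1 → part w ≡ P1 →
    u ≡ v ⊎ u ≡ w ⊎ v ≡ w

  GeneralizedV0V2 : Clause n → Set
  GeneralizedV0V2 C =
    (∀ {l} → l ∈ disj C → part (var l) ≡ P0) ×
    (∀ {l} → l ∈ par C → part (var l) ≡ P2) ×
    par C ≢ []

  Cond3 : Formula n → Set
  Cond3 φ = ∀ {C} → C ∈ φ →
    ((∃[ v ] (v occursIn C × part v ≡ P2)) → GeneralizedV0V2 C) ×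
    (¬ (∃[ v ] (v occursIn C × part v ≡ P2)) → par C ≡ [])

  NoMix : Formula n → Set
  NoMix φ = ∀ {C} → C ∈ φ → ∀ {u v} → u occursIn C → v occursIn C →
    part u ≡ P1 → part v ≡ P2 → ⊥

LocalPossibilityIC : ∀ {n} → Formula n → Set
LocalPossibilityIC {n} φ = Σ (Fin n → Part) λ part →
  NoMix part φ × Cond1 part φ × Cond2 part φ × Cond3 part φ

-- A domain is a local possibility domain exactly when it is closed under a ternary aggregator each of
-- whose components is ∧, ∨, majority or ⊕ (a basic aggregator).  Given a locally non-dictatorial
-- aggregator, every component has a ternary minor that is not a projection, because a unanimous
-- function all of whose ternary minors are projections is a dictatorship (its decisive sets form an
-- ultrafilter).  Some term in that minor is cyclic, and feeding the three rotations of one cyclic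
-- family into another keeps cyclicity, so all components become cyclic at once, hence basic.
-- Conversely, ∧/∨ on the renamed Horn part V0, majority on V1 and ⊕ on V2 preserve the models of a
-- local possibility integrity constraint.  Finally, a basic aggregator yields such a constraint: each
-- non-member x of D is cut off by a clause obtained by lowering V0-coordinates with ∧, by the
-- Baker–Pixley argument for majority on V1, or by Gaussian elimination over GF(2) on V2.

module Submission where

open import Defs
open import Data.Nat using (ℕ; zero; suc; s≤s; z≤n)
open import Data.Bool using (Bool; true; false; not; _∧_; _∨_; _xor_; if_then_else_)
open import Data.Bool.Properties as Bool
  using (∧-comm; ∧-assoc; ∨-comm; ∨-assoc; xor-comm; xor-assoc; not-involutive; not-injective; ∧-identityʳ; ∧-zeroʳ;
         ∨-zeroʳ; ∨-identityʳ; ∨-conicalˡ; ∨-conicalʳ; xor-∧-commutativeRing; not-distribˡ-xor; xor-annihilates-not;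
         ¬-not; not-¬; xor-same; xor-identityʳ)
open import Data.Fin using (Fin; _≟_) renaming (zero to #0; suc to fs)
open import Data.Fin.Properties using (all?; any?)
open import Data.Fin.Subset.Properties using (anySubset?)
open import Data.Vec as Vec using (Vec; []; _∷_; lookup; tabulate; replicate)
open import Data.Vec.Properties using (lookup∘tabulate; tabulate∘lookup; tabulate-cong; tabulate-∘; lookup-replicate)
open import Data.Vec.Relation.Binary.Pointwise.Extensional using (ext; Pointwise-≡⇒≡)
open import Data.List as List using (List; []; _∷_; _++_; allFin)
open import Data.List.Membership.Propositional using (_∈_; find; lose)
open import Data.List.Membership.Propositional.Properties
  using (∈-allFin; ∈-++⁺ʳ; ∈-++⁻; ∈-map⁺; ∈-map⁻; ∈-filter⁺; ∈-filter⁻; ∈-cartesianProductWith⁺;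
         ∈-concatMap⁺; ∈-concatMap⁻)
open import Data.List.Relation.Unary.Any as Any using (Any; here; there)
import Data.List.Relation.Unary.All as All
open import Data.Product using (Σ; _×_; _,_; proj₁; proj₂; ∃; ∃-syntax)
open import Data.Sum using (_⊎_; inj₁; inj₂)
open import Data.Empty using (⊥; ⊥-elim)
open import Function using (_∘_; _∘′_)
open import Function.Bundles using (_⇔_; mk⇔; Equivalence)
open import Relation.Binary.PropositionalEquality using (_≡_; _≢_; refl; sym; trans; cong; cong₂; subst; module ≡-Reasoning)
open import Relation.Nullary using (¬_; Dec; yes; no; ¬?; does)
open import Relation.Nullary.Decidable using (_⊎-dec_; _×-dec_; _→-dec_; map′; from-yes; decidable-stable; dec-true)
open import Algebra.Bundles using (CommutativeRing)
open import Algebra.Properties.CommutativeSemigroup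
  (CommutativeRing.+-commutativeSemigroup xor-∧-commutativeRing) using (interchange)
open Equivalence using (to; from)

Ternary : Set
Ternary = Bool → Bool → Bool → Bool

_≗₃_ : Ternary → Ternary → Set
f ≗₃ g = ∀ x y z → f x y z ≡ g x y z

cong₃ : (f : Ternary) {a a′ b b′ c c′ : Bool} → a ≡ a′ → b ≡ b′ → c ≡ c′ → f a b c ≡ f a′ b′ c′
cong₃ f refl refl refl = refl

Idempotent₃ : Ternary → Set
Idempotent₃ f = ∀ b → f b b b ≡ b

Cyclic : Ternary → Set
Cyclic f = ∀ x y z → f x y z ≡ f y z x

proj₃ : Fin 3 → Ternary
proj₃ d x y z = lookup (x ∷ y ∷ z ∷ []) d

cyclic⇒¬projection : ∀ {f} → Cyclic f → ∀ d → ¬ (f ≗₃ proj₃ d)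
cyclic⇒¬projection c #0 pr
  with () ← trans (sym (pr true false false)) (trans (c true false false) (trans (c false false true) (pr false true false)))
cyclic⇒¬projection c (fs #0) pr
  with () ← trans (sym (pr false true false)) (trans (sym (c false false true)) (pr false false true))
cyclic⇒¬projection c (fs (fs #0)) pr
  with () ← trans (sym (pr false false true)) (trans (sym (c true false false)) (pr true false false))

cyclic-determined : ∀ {f g} → Cyclic f → Cyclic g → Idempotent₃ f → Idempotent₃ g →
  f true false false ≡ g true false false → f true true false ≡ g true true false → f ≗₃ g
cyclic-determined {f} {g} cf cg if ig e₁ e₂ = agree
  where
  rotate : ∀ {x y z} → f y z x ≡ g y z x → f x y z ≡ g x y z
  rotate {x} {y} {z} e = trans (cf x y z) (trans e (sym (cg x y z)))
  agree : f ≗₃ g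
  agree false false false = trans (if false) (sym (ig false))
  agree true  true  true  = trans (if true) (sym (ig true))
  agree true  false false = e₁
  agree false true  false = rotate e₁
  agree false false true  = rotate (rotate e₁)
  agree true  true  false = e₂
  agree false true  true  = rotate e₂
  agree true  false true  = rotate (rotate e₂)

and₃ or₃ maj₃ xor₃ : Ternary
and₃ x y z = x ∧ y ∧ z
or₃ x y z = x ∨ y ∨ z
xor₃ x y z = x xor y xor z
maj₃ true  true  _ = true
maj₃ false false _ = false
maj₃ true  false z = z
maj₃ false true  z = z

data Basic : Set where
  AND OR MAJ XOR : Basic

⟦_⟧ : Basic → Ternary
⟦ AND ⟧ = and₃
⟦ OR ⟧ = or₃
⟦ MAJ ⟧ = maj₃
⟦ XOR ⟧ = xor₃

⟦⟧-idempotent : ∀ o → Idempotent₃ ⟦ o ⟧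
⟦⟧-idempotent AND b = trans (cong (b ∧_) (Bool.∧-idem b)) (Bool.∧-idem b)
⟦⟧-idempotent OR b = trans (cong (b ∨_) (Bool.∨-idem b)) (Bool.∨-idem b)
⟦⟧-idempotent MAJ true = refl
⟦⟧-idempotent MAJ false = refl
⟦⟧-idempotent XOR b = trans (cong (b xor_) (Bool.xor-same b)) (Bool.xor-identityʳ b)

⟦⟧-cyclic : ∀ o → Cyclic ⟦ o ⟧
⟦⟧-cyclic AND x y z = trans (∧-comm x (y ∧ z)) (∧-assoc y z x)
⟦⟧-cyclic OR x y z = trans (∨-comm x (y ∨ z)) (∨-assoc y z x)
⟦⟧-cyclic XOR x y z = trans (xor-comm x (y xor z)) (xor-assoc y z x)
⟦⟧-cyclic MAJ true  true  true  = refl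
⟦⟧-cyclic MAJ true  true  false = refl
⟦⟧-cyclic MAJ true  false true  = refl
⟦⟧-cyclic MAJ true  false false = refl
⟦⟧-cyclic MAJ false true  true  = refl
⟦⟧-cyclic MAJ false true  false = refl
⟦⟧-cyclic MAJ false false true  = refl
⟦⟧-cyclic MAJ false false false = refl

basic : Bool → Bool → Basic
basic false false = AND
basic false true = MAJ
basic true false = XOR
basic true true = OR

⟦basic⟧-100 : ∀ v w → ⟦ basic v w ⟧ true false false ≡ v
⟦basic⟧-100 false false = refl
⟦basic⟧-100 false true = refl
⟦basic⟧-100 true false = refl
⟦basic⟧-100 true true = refl

⟦basic⟧-110 : ∀ v w → ⟦ basic v w ⟧ true true false ≡ w
⟦basic⟧-110 false false = refl
⟦basic⟧-110 false true = refl
⟦basic⟧-110 true false = refl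
⟦basic⟧-110 true true = refl

cyclic-idempotent⇒basic : ∀ {f} → Cyclic f → Idempotent₃ f →
  f ≗₃ ⟦ basic (f true false false) (f true true false) ⟧
cyclic-idempotent⇒basic {f} cf if = cyclic-determined cf (⟦⟧-cyclic o) if (⟦⟧-idempotent o)
  (sym (⟦basic⟧-100 v w)) (sym (⟦basic⟧-110 v w))
  where
  v = f true false false
  w = f true true false
  o = basic v w

signed : Bool → Bool → Bool
signed s b = if s then b else not b

signed-and₃ : ∀ s x y z → signed s (and₃ x y z) ≡ (if s then and₃ else or₃) (signed s x) (signed s y) (signed s z)
signed-and₃ true x y z = refl
signed-and₃ false true true z = refl
signed-and₃ false true false z = refl
signed-and₃ false false y z = refl

signed-or₃ : ∀ s x y z → signed s (or₃ x y z) ≡ (if s then or₃ else and₃) (signed s x) (signed s y) (signed s z)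
signed-or₃ true x y z = refl
signed-or₃ false true y z = refl
signed-or₃ false false true z = refl
signed-or₃ false false false z = refl

signed-maj₃ : ∀ s x y z → signed s (maj₃ x y z) ≡ maj₃ (signed s x) (signed s y) (signed s z)
signed-maj₃ true x y z = refl
signed-maj₃ false true true z = refl
signed-maj₃ false true false z = refl
signed-maj₃ false false true z = refl
signed-maj₃ false false false z = refl

signed-xor₃ : ∀ s x y z → signed s (xor₃ x y z) ≡ xor₃ (signed s x) (signed s y) (signed s z)
signed-xor₃ true x y z = refl
signed-xor₃ false x y z = trans (not-distribˡ-xor x (y xor z)) (cong (not x xor_) (sym (xor-annihilates-not y z)))

xor₃-interchange : ∀ x y z x′ y′ z′ → xor₃ x y z xor xor₃ x′ y′ z′ ≡ xor₃ (x xor x′) (y xor y′) (z xor z′)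
xor₃-interchange x y z x′ y′ z′ =
  trans (interchange x (y xor z) x′ (y′ xor z′)) (cong ((x xor x′) xor_) (interchange y z y′ z′))

or₃-false : ∀ x y z → or₃ x y z ≡ false → x ≡ false × y ≡ false × z ≡ false
or₃-false false false false _ = refl , refl , refl

and₃-false : ∀ x y z → and₃ x y z ≡ false → x ≡ false ⊎ y ≡ false ⊎ z ≡ false
and₃-false false _ _ _ = inj₁ refl
and₃-false true false _ _ = inj₂ (inj₁ refl)
and₃-false true true false _ = inj₂ (inj₂ refl)

maj₃-false : ∀ x y z → maj₃ x y z ≡ false →
  (x ≡ true → y ≡ true → ⊥) × (x ≡ true → z ≡ true → ⊥) × (y ≡ true → z ≡ true → ⊥)
maj₃-false true false false _ = (λ _ ()) , (λ _ ()) , λ ()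
maj₃-false false true false _ = (λ ()) , (λ ()) , λ _ ()
maj₃-false false false _ _ = (λ ()) , (λ ()) , λ ()

renamed-and₃ : ∀ x y z → and₃ x y z xor false ≡ and₃ (x xor false) (y xor false) (z xor false)
renamed-and₃ x y z rewrite xor-identityʳ x | xor-identityʳ y | xor-identityʳ z = xor-identityʳ _

renamed-or₃ : ∀ x y z → or₃ x y z xor true ≡ and₃ (x xor true) (y xor true) (z xor true)
renamed-or₃ true y z = refl
renamed-or₃ false true z = refl
renamed-or₃ false false true = refl
renamed-or₃ false false false = refl

xor-cancelʳ : ∀ x y w → x xor w ≡ y xor w → x ≡ y
xor-cancelʳ true true w _ = refl
xor-cancelʳ false false w _ = refl
xor-cancelʳ true false w e = ⊥-elim (not-¬ refl (sym e))
xor-cancelʳ false true w e = ⊥-elim (not-¬ refl e)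

and₃-meet : ∀ p q → and₃ (and₃ p q q) (and₃ p p q) (and₃ p p q) ≡ p ∧ q
and₃-meet true true = refl
and₃-meet true false = refl
and₃-meet false q = refl

maj₃-meet : ∀ p q → maj₃ (maj₃ p q q) (maj₃ p p q) (maj₃ p p q) ≡ p
maj₃-meet true true = refl
maj₃-meet true false = refl
maj₃-meet false true = refl
maj₃-meet false false = refl

xor₃-meet : ∀ p q → xor₃ (xor₃ p q q) (xor₃ p p q) (xor₃ p p q) ≡ p
xor₃-meet true true = refl
xor₃-meet true false = refl
xor₃-meet false true = refl
xor₃-meet false false = refl

maj₃-xxy : ∀ p q → maj₃ p p q ≡ p
maj₃-xxy true q = refl
maj₃-xxy false q = refl

xor₃-xxy : ∀ p q → xor₃ p p q ≡ q
xor₃-xxy p q = trans (sym (Bool.xor-assoc p p q)) (cong (_xor q) (xor-same p))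

maj₃-agree : ∀ {p q r t} → (p ≡ t × q ≡ t) ⊎ (p ≡ t × r ≡ t) ⊎ (q ≡ t × r ≡ t) → maj₃ p q r ≡ t
maj₃-agree {r = r} {t} (inj₁ (refl , refl)) = maj₃-xxy t r
maj₃-agree {q = true} {t = true} (inj₂ (inj₁ (refl , refl))) = refl
maj₃-agree {q = false} {t = true} (inj₂ (inj₁ (refl , refl))) = refl
maj₃-agree {q = true} {t = false} (inj₂ (inj₁ (refl , refl))) = refl
maj₃-agree {q = false} {t = false} (inj₂ (inj₁ (refl , refl))) = refl
maj₃-agree {p = true} {t = true} (inj₂ (inj₂ (refl , refl))) = refl
maj₃-agree {p = false} {t = true} (inj₂ (inj₂ (refl , refl))) = refl
maj₃-agree {p = true} {t = false} (inj₂ (inj₂ (refl , refl))) = refl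
maj₃-agree {p = false} {t = false} (inj₂ (inj₂ (refl , refl))) = refl

xor₃-xyy : ∀ p q → xor₃ p q q ≡ p
xor₃-xyy p q = trans (cong (p xor_) (xor-same q)) (xor-identityʳ p)

xor₃-distinct : ∀ p {q r} → q ≢ r → xor₃ p q r ≡ not p
xor₃-distinct p {true} {true} q≢r = ⊥-elim (q≢r refl)
xor₃-distinct p {true} {false} _ = Bool.xor-comm p true
xor₃-distinct p {false} {true} _ = Bool.xor-comm p true
xor₃-distinct p {false} {false} q≢r = ⊥-elim (q≢r refl)

xor-solve : ∀ h a p k → h xor a ≡ p xor k → h ≡ (a xor p) xor k
xor-solve h false p k e = trans (sym (xor-identityʳ h)) e
xor-solve h true p k e = trans (sym (not-involutive h))
  (trans (cong not (trans (Bool.xor-comm true h) e)) (Bool.not-distribˡ-xor p k))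

xor-cancel-left : ∀ p k → (p xor k) xor p ≡ k
xor-cancel-left p k = trans (cong (_xor p) (Bool.xor-comm p k))
  (trans (Bool.xor-assoc k p p) (trans (cong (k xor_) (xor-same p)) (xor-identityʳ k)))

signed-not-xor : ∀ c b p → (if not c then b else not b) xor p ≡ (b xor p) xor c
signed-not-xor false b p = sym (xor-identityʳ (b xor p))
signed-not-xor true b p = trans (sym (Bool.not-distribˡ-xor b p)) (Bool.xor-comm true (b xor p))

≢⇒xor-true : ∀ {p q} → p ≢ q → p xor q ≡ true
≢⇒xor-true {p} {q} p≢q = trans (cong (_xor q) (¬-not p≢q)) (Bool.xor-inverseˡ q)

pigeonhole : ∀ {A : Set} {u v a b c : A} →
  a ≡ u ⊎ a ≡ v → b ≡ u ⊎ b ≡ v → c ≡ u ⊎ c ≡ v → a ≡ b ⊎ a ≡ c ⊎ b ≡ c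
pigeonhole (inj₁ refl) (inj₁ refl) _ = inj₁ refl
pigeonhole (inj₂ refl) (inj₂ refl) _ = inj₁ refl
pigeonhole (inj₁ refl) (inj₂ refl) (inj₁ refl) = inj₂ (inj₁ refl)
pigeonhole (inj₁ refl) (inj₂ refl) (inj₂ refl) = inj₂ (inj₂ refl)
pigeonhole (inj₂ refl) (inj₁ refl) (inj₁ refl) = inj₂ (inj₂ refl)
pigeonhole (inj₂ refl) (inj₁ refl) (inj₂ refl) = inj₂ (inj₁ refl)

-- Cyclic terms of idempotent ternary operations

∀-Bool? : {P : Bool → Set} → (∀ b → Dec (P b)) → Dec (∀ b → P b)
∀-Bool? P? = map′ (λ (pt , pf) → λ { true → pt ; false → pf }) (λ p → p true , p false) (P? true ×-dec P? false)

_≗₃?_ : (f g : Ternary) → Dec (f ≗₃ g)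
f ≗₃? g = ∀-Bool? λ x → ∀-Bool? λ y → ∀-Bool? λ z → f x y z Bool.≟ g x y z

cyclic? : ∀ f → Dec (Cyclic f)
cyclic? f = f ≗₃? λ x y z → f y z x

Projection : Ternary → Set
Projection f = ∃[ d ] f ≗₃ proj₃ d

projection? : ∀ f → Dec (Projection f)
projection? f = any? λ d → f ≗₃? proj₃ d

projection-resp : ∀ {f g} → f ≗₃ g → Projection g → Projection f
projection-resp f≗g (d , g≗pr) = d , λ x y z → trans (f≗g x y z) (g≗pr x y z)

data Term : Set where
  x₁ x₂ x₃ : Term
  app : Term → Term → Term → Term

eval : Term → Ternary → Ternary
eval x₁ f x y z = x
eval x₂ f x y z = y
eval x₃ f x y z = z
eval (app t₁ t₂ t₃) f x y z = f (eval t₁ f x y z) (eval t₂ f x y z) (eval t₃ f x y z)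

cyclicCandidates : List Term
cyclicCandidates =
  app x₁ (app x₁ x₂ x₂) (app x₂ x₃ x₁) ∷
  app (app x₁ x₁ x₂) (app x₂ x₂ x₁) (app x₁ x₂ x₃) ∷
  app (app x₁ x₂ x₁) (app x₁ x₃ x₂) (app x₂ x₁ x₂) ∷
  app (app x₁ x₂ x₃) (app x₃ x₂ x₂) (app x₂ x₃ x₃) ∷
  []

tabled : Vec Bool 6 → Ternary
tabled _                                 false false false = false
tabled (b ∷ _)                           false false true  = b
tabled (_ ∷ b ∷ _)                       false true  false = b
tabled (_ ∷ _ ∷ b ∷ _)                   false true  true  = b
tabled (_ ∷ _ ∷ _ ∷ b ∷ _)               true  false false = b
tabled (_ ∷ _ ∷ _ ∷ _ ∷ b ∷ _)           true  false true  = b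
tabled (_ ∷ _ ∷ _ ∷ _ ∷ _ ∷ b ∷ [])      true  true  false = b
tabled _                                 true  true  true  = true

HasCyclicCandidate : Ternary → Set
HasCyclicCandidate f = Any (λ t → Cyclic (eval t f)) cyclicCandidates

∀-Vec-Bool? : ∀ {n} {P : Vec Bool n → Set} → (∀ v → Dec (P v)) → Dec (∀ v → P v)
∀-Vec-Bool? P? = map′ (λ ¬∃¬ v → decidable-stable (P? v) (λ ¬p → ¬∃¬ (v , ¬p)))
                      (λ ∀P (v , ¬p) → ¬p (∀P v))
                      (¬? (anySubset? (λ v → ¬? (P? v))))

-- A check over all 64 idempotent ternary operations, kept opaque so that it is never unfolded.
opaque
  tables-projection-or-cyclic : ∀ v → Projection (tabled v) ⊎ HasCyclicCandidate (tabled v)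
  tables-projection-or-cyclic = from-yes (∀-Vec-Bool? λ v →
    projection? (tabled v) ⊎-dec Any.any? (λ t → cyclic? (eval t (tabled v))) cyclicCandidates)

tableOf : Ternary → Vec Bool 6
tableOf f = f false false true ∷ f false true false ∷ f false true true ∷
            f true false false ∷ f true false true ∷ f true true false ∷ []

idempotent≗tabled : ∀ {f} → Idempotent₃ f → f ≗₃ tabled (tableOf f)
idempotent≗tabled i false false false = i false
idempotent≗tabled i false false true  = refl
idempotent≗tabled i false true  false = refl
idempotent≗tabled i false true  true  = refl
idempotent≗tabled i true  false false = refl
idempotent≗tabled i true  false true  = refl
idempotent≗tabled i true  true  false = refl
idempotent≗tabled i true  true  true  = i true

eval-cong : ∀ {f g} → f ≗₃ g → ∀ t → eval t f ≗₃ eval t g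
eval-cong f≗g x₁ x y z = refl
eval-cong f≗g x₂ x y z = refl
eval-cong f≗g x₃ x y z = refl
eval-cong f≗g (app t₁ t₂ t₃) x y z
  rewrite eval-cong f≗g t₁ x y z | eval-cong f≗g t₂ x y z | eval-cong f≗g t₃ x y z = f≗g _ _ _

eval-idempotent : ∀ {f} → Idempotent₃ f → ∀ t → Idempotent₃ (eval t f)
eval-idempotent i x₁ b = refl
eval-idempotent i x₂ b = refl
eval-idempotent i x₃ b = refl
eval-idempotent {f} i (app t₁ t₂ t₃) b =
  trans (cong₃ f (eval-idempotent i t₁ b) (eval-idempotent i t₂ b) (eval-idempotent i t₃ b)) (i b)

cyclic-resp : ∀ {f g} → f ≗₃ g → Cyclic g → Cyclic f
cyclic-resp f≗g c x y z = trans (f≗g x y z) (trans (c x y z) (sym (f≗g y z x)))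

idempotent∧¬projection⇒cyclicTerm : ∀ {f} → Idempotent₃ f → ¬ Projection f → ∃[ t ] Cyclic (eval t f)
idempotent∧¬projection⇒cyclicTerm {f} i ¬pr with tables-projection-or-cyclic (tableOf f)
... | inj₁ (d , pr) = ⊥-elim (¬pr (d , λ x y z → trans (idempotent≗tabled i x y z) (pr x y z)))
... | inj₂ cyc with t , c ← Any.satisfied cyc = t , cyclic-resp (eval-cong (idempotent≗tabled i) t) c

_⊳_ : Ternary → Ternary → Ternary
(g ⊳ h) x y z = h (g x y z) (g y z x) (g z x y)

⊳-idempotent : ∀ {g h} → Idempotent₃ g → Idempotent₃ h → Idempotent₃ (g ⊳ h)
⊳-idempotent {g} {h} ig ih b = trans (cong₃ h (ig b) (ig b) (ig b)) (ih b)

⊳-cyclic-right : ∀ {g h} → Cyclic h → Cyclic (g ⊳ h)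
⊳-cyclic-right {g} ch x y z = ch (g x y z) (g y z x) (g z x y)

⊳-cyclic-left : ∀ {g h} → Cyclic g → Idempotent₃ h → Cyclic (g ⊳ h)
⊳-cyclic-left {g} {h} cg ih x y z = trans (collapse x y z) (trans (cg x y z) (sym (collapse y z x)))
  where
  collapse : ∀ x y z → (g ⊳ h) x y z ≡ g x y z
  collapse x y z = trans (cong₃ h refl (sym (cg x y z)) (sym (trans (cg x y z) (cg y z x)))) (ih (g x y z))

-- Minors of unanimous Boolean functions

pick : ∀ {A : Set} → Bool → Bool → A → A → A → A
pick s t x y z = if s then x else if t then y else z

pick-float : ∀ {A B : Set} (h : A → B) s t {x y z} → h (pick s t x y z) ≡ pick s t (h x) (h y) (h z)
pick-float h true t = refl
pick-float h false true = refl
pick-float h false false = refl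

module _ {k : ℕ} (F : Vec Bool k → Bool) where

  F̂ : (Fin k → Bool) → Bool
  F̂ p = F (tabulate p)

  F̂-cong : ∀ {p q} → (∀ i → p i ≡ q i) → F̂ p ≡ F̂ q
  F̂-cong p≗q = cong F (tabulate-cong p≗q)

  F̂-const : Unanimous F → ∀ b → F̂ (λ _ → b) ≡ b
  F̂-const unanimous b = trans (cong F tabulate-const) (unanimous b)
    where
    tabulate-const : tabulate (λ _ → b) ≡ replicate k b
    tabulate-const = trans (tabulate-cong (λ i → sym (lookup-replicate i b))) (tabulate∘lookup _)

  minor : (Fin k → Bool) → (Fin k → Bool) → Ternary
  minor p q x y z = F̂ (λ i → pick (p i) (q i) x y z)

_∖_ : ∀ {k} → (Fin k → Bool) → (Fin k → Bool) → Fin k → Bool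
(q ∖ p) i = not (p i) ∧ q i

⁅_⁆ : ∀ {k} → Fin k → Fin k → Bool
⁅ l ⁆ i = does (i ≟ l)

not-∨ : ∀ a b → not (a ∨ b) ≡ not a ∧ not b
not-∨ true b = refl
not-∨ false b = refl

∖-singleton : ∀ {k} (p : Fin k → Bool) l → p l ≡ false → ∀ i → p i ≡ (p ∖ ⁅ l ⁆) i
∖-singleton p l pl i with i ≟ l
... | yes refl = pl
... | no _ = refl

module _ {k : ℕ} (F : Vec Bool k → Bool) (unanimous : Unanimous F)
         (minors-projections : ∀ p q → Projection (minor F p q)) where

  private
    G : (Fin k → Bool) → Bool
    G = F̂ F

    G-const : ∀ b → G (λ _ → b) ≡ b
    G-const = F̂-const F unanimous

  blocks : ∀ p q → ∃[ d ] (G p ≡ proj₃ d true false false × G (q ∖ p) ≡ proj₃ d false true false ×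
                          G ((not ∘ q) ∖ p) ≡ proj₃ d false false true)
  blocks p q with d , pr ← minors-projections p q =
    d , trans (F̂-cong F block₁) (pr _ _ _) , trans (F̂-cong F block₂) (pr _ _ _) , trans (F̂-cong F block₃) (pr _ _ _)
    where
    block₁ : ∀ i → p i ≡ pick (p i) (q i) true false false
    block₁ i with p i | q i
    ... | true | _ = refl
    ... | false | true = refl
    ... | false | false = refl
    block₂ : ∀ i → (q ∖ p) i ≡ pick (p i) (q i) false true false
    block₂ i with p i | q i
    ... | true | _ = refl
    ... | false | true = refl
    ... | false | false = refl
    block₃ : ∀ i → ((not ∘ q) ∖ p) i ≡ pick (p i) (q i) false false true
    block₃ i with p i | q i
    ... | true | _ = refl
    ... | false | true = refl
    ... | false | false = refl

  block-true : ∀ p q → G p ≡ true → G (q ∖ p) ≡ false × G ((not ∘ q) ∖ p) ≡ false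
  block-true p q Gp with blocks p q
  ... | #0 , _ , e₂ , e₃ = e₂ , e₃
  ... | fs #0 , e₁ , _ , _ with () ← trans (sym Gp) e₁
  ... | fs (fs #0) , e₁ , _ , _ with () ← trans (sym Gp) e₁

  block-false : ∀ p q → G p ≡ false → G (q ∖ p) ≡ true ⊎ G ((not ∘ q) ∖ p) ≡ true
  block-false p q Gp with blocks p q
  ... | #0 , e₁ , _ , _ with () ← trans (sym Gp) e₁
  ... | fs #0 , _ , e₂ , _ = inj₁ e₂
  ... | fs (fs #0) , _ , _ , e₃ = inj₂ e₃

  G-complement : ∀ p → G (not ∘ p) ≡ not (G p)
  G-complement p with G p in Gp
  ... | true = trans (F̂-cong F (λ i → sym (∧-identityʳ (not (p i))))) (proj₁ (block-true p (λ _ → true) Gp))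
  ... | false with block-false p (λ _ → true) Gp
  ...   | inj₁ e = trans (F̂-cong F (λ i → sym (∧-identityʳ (not (p i))))) e
  ...   | inj₂ e with () ← trans (sym e) (trans (F̂-cong F (λ i → ∧-zeroʳ (not (p i)))) (G-const false))

  inList : List (Fin k) → Fin k → Bool
  inList [] i = false
  inList (l ∷ Ls) i = ⁅ l ⁆ i ∨ inList Ls i

  inList-∈ : ∀ {i} Ls → i ∈ Ls → inList Ls i ≡ true
  inList-∈ {i} (l ∷ Ls) (here refl) rewrite dec-true (i ≟ i) refl = refl
  inList-∈ {i} (l ∷ Ls) (there i∈Ls) rewrite inList-∈ Ls i∈Ls = ∨-zeroʳ _

  inList-allFin : ∀ i → inList (allFin k) i ≡ true
  inList-allFin i = inList-∈ (allFin k) (∈-allFin i)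

  singleton-or-complement : ∀ Ls → (∃[ l ] G ⁅ l ⁆ ≡ true) ⊎ G (not ∘ inList Ls) ≡ true
  singleton-or-complement [] = inj₂ (G-const true)
  singleton-or-complement (l ∷ Ls) with singleton-or-complement Ls
  ... | inj₁ found = inj₁ found
  ... | inj₂ rest with G ⁅ l ⁆ in Gl
  ...   | true = inj₁ (l , Gl)
  ...   | false with block-false ⁅ l ⁆ (not ∘ inList Ls) Gl
  ...     | inj₁ e = inj₂ (trans (F̂-cong F (λ i → not-∨ (⁅ l ⁆ i) (inList Ls i))) e)
  ...     | inj₂ e with () ← trans (sym e) (trans (F̂-cong F (λ i → ∧-comm (not (⁅ l ⁆ i)) _))
                                                 (proj₁ (block-true (not ∘ inList Ls) (not ∘ ⁅ l ⁆) rest)))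

  decisive-singleton : ∃[ l ] G ⁅ l ⁆ ≡ true
  decisive-singleton with singleton-or-complement (allFin k)
  ... | inj₁ found = found
  ... | inj₂ e with () ← trans (sym e) (trans (F̂-cong F (λ i → cong not (inList-allFin i))) (G-const false))

  minors-projections⇒projection : ∃[ l ] IsProjection F l
  minors-projections⇒projection = l , λ v → trans (cong F (sym (tabulate∘lookup v))) (G-lookup (lookup v))
    where
    l = proj₁ decisive-singleton
    Gl = proj₂ decisive-singleton
    G-lookup : ∀ p → G p ≡ p l
    G-lookup p with p l in pl
    ... | false = trans (F̂-cong F (∖-singleton p l pl)) (proj₁ (block-true ⁅ l ⁆ p Gl))
    ... | true = trans (sym (not-involutive _)) (cong not (trans (sym (G-complement p))
                   (trans (F̂-cong F (∖-singleton (not ∘ p) l (cong not pl))) (proj₂ (block-true ⁅ l ⁆ p Gl)))))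

apply₃ : ∀ {n} → (Fin n → Ternary) → Vec Bool n → Vec Bool n → Vec Bool n → Vec Bool n
apply₃ g a b c = tabulate λ j → g j (lookup a j) (lookup b j) (lookup c j)

Closed : ∀ {n} → Domain n → (Fin n → Ternary) → Set
Closed D g = ∀ a b c → a ∈D D → b ∈D D → c ∈D D → apply₃ g a b c ∈D D

module _ {n : ℕ} {D : Domain n} where

  ∈D-cong : ∀ {a b} → a ≡ b → a ∈D D → b ∈D D
  ∈D-cong a≡b = subst (_∈D D) a≡b

  closed-resp : ∀ {g h} → (∀ j → g j ≗₃ h j) → Closed D g → Closed D h
  closed-resp g≗h cl a b c aD bD cD = ∈D-cong (tabulate-cong λ j → g≗h j _ _ _) (cl a b c aD bD cD)

  closed-first : Closed D (λ _ x _ _ → x)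
  closed-first a _ _ aD _ _ = ∈D-cong (sym (tabulate∘lookup a)) aD

  closed-superposition : ∀ {h u v w} → Closed D h → Closed D u → Closed D v → Closed D w →
    Closed D (λ j x y z → h j (u j x y z) (v j x y z) (w j x y z))
  closed-superposition {h} h-cl u-cl v-cl w-cl a b c aD bD cD =
    ∈D-cong (tabulate-cong λ j → cong₃ (h j) (lookup∘tabulate _ j) (lookup∘tabulate _ j) (lookup∘tabulate _ j))
            (h-cl _ _ _ (u-cl a b c aD bD cD) (v-cl a b c aD bD cD) (w-cl a b c aD bD cD))

  closed-eval : ∀ {g} → Closed D g → ∀ t → Closed D (λ j → eval t (g j))
  closed-eval g-cl x₁ = closed-first
  closed-eval g-cl x₂ a b c aD bD cD = closed-first b c a bD cD aD
  closed-eval g-cl x₃ a b c aD bD cD = closed-first c a b cD aD bD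
  closed-eval {g} g-cl (app t₁ t₂ t₃) =
    closed-superposition {h = g} {λ j → eval t₁ (g j)} {λ j → eval t₂ (g j)} {λ j → eval t₃ (g j)} g-cl
      (closed-eval {g} g-cl t₁) (closed-eval {g} g-cl t₂) (closed-eval {g} g-cl t₃)

  closed-⊳ : ∀ {g h} → Closed D g → Closed D h → Closed D (λ j → g j ⊳ h j)
  closed-⊳ {g} {h} g-cl h-cl =
    closed-superposition {h = h} {u = g} {v = λ j x y z → g j y z x} {w = λ j x y z → g j z x y} h-cl g-cl
      (λ a b c aD bD cD → g-cl b c a bD cD aD) (λ a b c aD bD cD → g-cl c a b cD aD bD)

  CyclicFamily : List (Fin n) → Set
  CyclicFamily Ls = ∃[ g ] Closed D g × (∀ j → Idempotent₃ (g j)) × (∀ {j} → j ∈ Ls → Cyclic (g j))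

  combine : ∀ {Ls Ms} → CyclicFamily Ls → CyclicFamily Ms → CyclicFamily (Ms ++ Ls)
  combine {Ls} {Ms} (g , g-cl , g-idem , g-cyc) (h , h-cl , h-idem , h-cyc) =
    (λ j → g j ⊳ h j) , closed-⊳ {g = g} {h = h} g-cl h-cl , (λ j → ⊳-idempotent {g j} {h j} (g-idem j) (h-idem j)) ,
    cyclic
    where
    cyclic : ∀ {j} → j ∈ Ms ++ Ls → Cyclic (g j ⊳ h j)
    cyclic {j} j∈ with ∈-++⁻ Ms j∈
    ... | inj₁ j∈Ms = ⊳-cyclic-right {g j} {h j} (h-cyc j∈Ms)
    ... | inj₂ j∈Ls = ⊳-cyclic-left {g j} {h j} (g-cyc j∈Ls) (h-idem j)

-- From a locally non-dictatorial aggregator to a basic one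

module _ {n k : ℕ} {D : Domain n} {f : Fin n → Vec Bool k → Bool} (agg : IsAggregator k D f) where

  closed-minor : ∀ p q → Closed D (λ j → minor (f j) p q)
  closed-minor p q a b c aD bD cD = ∈D-cong {D = D} (tabulate-cong coordinate) (proj₂ agg xs xs∈D)
    where
    xs = tabulate λ i → pick (p i) (q i) a b c
    xs∈D : ∀ i → lookup xs i ∈D D
    xs∈D i rewrite lookup∘tabulate (λ i → pick (p i) (q i) a b c) i with p i | q i
    ... | true | _ = aD
    ... | false | true = bD
    ... | false | false = cD
    coordinate : ∀ j → f j (Vec.map (λ x → lookup x j) xs) ≡ minor (f j) p q (lookup a j) (lookup b j) (lookup c j)
    coordinate j = cong (f j) (trans (sym (tabulate-∘ (λ x → lookup x j) _))
                                      (tabulate-cong λ i → pick-float (λ x → lookup x j) (p i) (q i)))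

  minor-idempotent : ∀ j p q → Idempotent₃ (minor (f j) p q)
  minor-idempotent j p q b = trans (F̂-cong (f j) (λ i → pick-same (p i) (q i))) (F̂-const (f j) (proj₁ agg j) b)
    where
    pick-same : ∀ s t → pick s t b b b ≡ b
    pick-same true t = refl
    pick-same false true = refl
    pick-same false false = refl

  module _ (lnd : LocallyNonDictatorial f) where

    nonprojective-minor : ∀ j → ∃[ p ] ∃[ q ] ¬ Projection (minor (f j) p q)
    nonprojective-minor j
      with anySubset? (λ p → anySubset? λ q → ¬? (projection? (minor (f j) (lookup p) (lookup q))))
    ... | yes (p , q , ¬pr) = lookup p , lookup q , ¬pr
    ... | no none = ⊥-elim (lnd j (proj₁ f-projection) (proj₂ f-projection))
      where
      all-projections : ∀ p q → Projection (minor (f j) p q)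
      all-projections p q = projection-resp
        (λ x y z → F̂-cong (f j) λ i →
          cong₂ (λ s t → pick s t x y z) (sym (lookup∘tabulate p i)) (sym (lookup∘tabulate q i)))
        (decidable-stable (projection? _) λ ¬pr → none (tabulate p , tabulate q , ¬pr))
      f-projection : ∃[ d ] IsProjection (f j) d
      f-projection = minors-projections⇒projection (f j) (proj₁ agg j) all-projections

    cyclic-at : ∀ l → CyclicFamily (l ∷ [])
    cyclic-at l with p , q , ¬pr ← nonprojective-minor l
                 with t , cyc ← idempotent∧¬projection⇒cyclicTerm (minor-idempotent l p q) ¬pr =
      (λ j → eval t (minor (f j) p q)) ,
      closed-eval (closed-minor p q) t , (λ j → eval-idempotent (minor-idempotent j p q) t) ,
      λ { (here refl) → cyc }

    cyclic-everywhere : ∀ Ls → CyclicFamily Ls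
    cyclic-everywhere [] = (λ _ x _ _ → x) , closed-first , (λ _ _ → refl) , λ ()
    cyclic-everywhere (l ∷ Ls) = combine (cyclic-everywhere Ls) (cyclic-at l)

    aggregator⇒basic-closure : ∃[ op ] Closed D (λ j → ⟦ op j ⟧)
    aggregator⇒basic-closure with g , g-cl , g-idem , g-cyc ← cyclic-everywhere (allFin n) =
      (λ j → basic (g j true false false) (g j true true false)) ,
      closed-resp (λ j → cyclic-idempotent⇒basic (g-cyc (∈-allFin j)) (g-idem j)) g-cl

module _ {n : ℕ} (a : Vec Bool n) where

  anyTrue-intro : ∀ {l} Ls → l ∈ Ls → evalLit a l ≡ true → anyTrue (evalLits a Ls) ≡ true
  anyTrue-intro (l ∷ Ls) (here refl) al rewrite al = refl
  anyTrue-intro (l ∷ Ls) (there l∈) al rewrite anyTrue-intro Ls l∈ al = ∨-zeroʳ _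

  anyTrue-elim : ∀ Ls → anyTrue (evalLits a Ls) ≡ true → ∃[ l ] l ∈ Ls × evalLit a l ≡ true
  anyTrue-elim (l ∷ Ls) e with evalLit a l in al
  ... | true = l , here refl , al
  ... | false with l′ , l′∈ , al′ ← anyTrue-elim Ls e = l′ , there l′∈ , al′

  anyFalse-elim : ∀ {l} Ls → anyTrue (evalLits a Ls) ≡ false → l ∈ Ls → evalLit a l ≡ false
  anyFalse-elim (l ∷ Ls) e (here refl) = ∨-conicalˡ _ _ e
  anyFalse-elim (l ∷ Ls) e (there l∈) = anyFalse-elim Ls (∨-conicalʳ _ _ e) l∈

  anyFalse-intro : ∀ Ls → (∀ {l} → l ∈ Ls → evalLit a l ≡ false) → anyTrue (evalLits a Ls) ≡ false
  anyFalse-intro [] _ = refl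
  anyFalse-intro (l ∷ Ls) all-false rewrite all-false (here refl) = anyFalse-intro Ls (all-false ∘′ there)

  sat-by-literal : ∀ {C l} → l ∈ disj C → evalLit a l ≡ true → SatClause a C
  sat-by-literal {C} l∈ al rewrite anyTrue-intro (disj C) l∈ al = refl

  sat-by-parity : ∀ {C} → parity (evalLits a (par C)) ≡ true → SatClause a C
  sat-by-parity e rewrite e = ∨-zeroʳ _

  unsat : ∀ {C} → anyTrue (evalLits a (disj C)) ≡ false → parity (evalLits a (par C)) ≡ false → ¬ SatClause a C
  unsat e₁ e₂ s with () ← trans (sym s) (cong₂ _∨_ e₁ e₂)

  sat-ordinary : ∀ {C} → par C ≡ [] → SatClause a C → anyTrue (evalLits a (disj C)) ≡ true
  sat-ordinary {C} p≡[] s rewrite p≡[] = trans (sym (∨-identityʳ _)) s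

evalLit-apply₃ : ∀ {n} g (a b c : Vec Bool n) l →
  evalLit (apply₃ g a b c) l ≡ signed (sign l) (g (var l) (lookup a (var l)) (lookup b (var l)) (lookup c (var l)))
evalLit-apply₃ g a b c l = cong (signed (sign l)) (lookup∘tabulate _ (var l))

complementary-false : ∀ {n} (t : Vec Bool n) {l l′} → var l ≡ var l′ →
  evalLit t l ≡ false → evalLit t l′ ≡ false → l ≡ l′
complementary-false t {lit v s} {lit .v s′} refl tl tl′ with lookup t v | s | s′
... | _ | true | true = refl
... | _ | false | false = refl
... | true | true | false with () ← tl
... | false | true | false with () ← tl′
... | true | false | true with () ← tl′
... | false | false | true with () ← tl

evalLits-positive : ∀ {n} (a : Vec Bool n) T → evalLits a (List.map (λ s → lit s true) T) ≡ List.map (lookup a) T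
evalLits-positive a [] = refl
evalLits-positive a (s ∷ T) = cong (lookup a s ∷_) (evalLits-positive a T)

module Renaming {n : ℕ} (part : Fin n → Part) (W : Fin n → Bool) where

  renameLits-∈⁺ : ∀ {l} Ls → l ∈ Ls → renameLit part W l ∈ renameLits part W Ls
  renameLits-∈⁺ (l ∷ Ls) (here refl) = here refl
  renameLits-∈⁺ (l ∷ Ls) (there l∈) = there (renameLits-∈⁺ Ls l∈)

  renameLits-∈⁻ : ∀ {l′} Ls → l′ ∈ renameLits part W Ls → ∃[ l ] l ∈ Ls × l′ ≡ renameLit part W l
  renameLits-∈⁻ (l ∷ Ls) (here refl) = l , here refl , refl
  renameLits-∈⁻ (l ∷ Ls) (there l′∈) with l , l∈ , e ← renameLits-∈⁻ Ls l′∈ = l , there l∈ , e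

  renameClause-∈⁺ : ∀ {l C} → l ∈L C → renameLit part W l ∈L renameClause part W C
  renameClause-∈⁺ {C = C} (inj₁ l∈) = inj₁ (renameLits-∈⁺ (disj C) l∈)
  renameClause-∈⁺ {C = C} (inj₂ l∈) = inj₂ (renameLits-∈⁺ (par C) l∈)

  renameClause-∈⁻ : ∀ {l′ C} → l′ ∈L renameClause part W C → ∃[ l ] l ∈L C × l′ ≡ renameLit part W l
  renameClause-∈⁻ {C = C} (inj₁ l′∈) with l , l∈ , e ← renameLits-∈⁻ (disj C) l′∈ = l , inj₁ l∈ , e
  renameClause-∈⁻ {C = C} (inj₂ l′∈) with l , l∈ , e ← renameLits-∈⁻ (par C) l′∈ = l , inj₂ l∈ , e

  renameFormula-∈⁺ : ∀ {C} φ → C ∈ φ → renameClause part W C ∈ renameFormula part W φ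
  renameFormula-∈⁺ (C ∷ φ) (here refl) = here refl
  renameFormula-∈⁺ (C ∷ φ) (there C∈) = there (renameFormula-∈⁺ φ C∈)

  renameFormula-∈⁻ : ∀ {C′} φ → C′ ∈ renameFormula part W φ → ∃[ C ] C ∈ φ × C′ ≡ renameClause part W C
  renameFormula-∈⁻ (C ∷ φ) (here refl) = C , here refl , refl
  renameFormula-∈⁻ (C ∷ φ) (there C′∈) with C , C∈ , e ← renameFormula-∈⁻ φ C′∈ = C , there C∈ , e

  onlyV0-rename : ∀ {C} → OnlyV0 part C → OnlyV0 part (renameClause part W C)
  onlyV0-rename only l′∈ with l , l∈ , refl ← renameClause-∈⁻ l′∈ = only l∈

  onlyV0-unrename : ∀ {C} → OnlyV0 part (renameClause part W C) → OnlyV0 part C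
  onlyV0-unrename only l∈ = only (renameClause-∈⁺ l∈)

  renameLit-injective : ∀ {l l′} → renameLit part W l ≡ renameLit part W l′ → l ≡ l′
  renameLit-injective {lit v s} {lit v′ s′} e with refl ← cong var e with W v | cong sign e
  ... | true | e′ = cong (lit v) (not-injective e′)
  ... | false | e′ = cong (lit v) e′

-- From an integrity constraint to a basic aggregator

_≟ᴾ_ : (p q : Part) → Dec (p ≡ q)
P0 ≟ᴾ P0 = yes refl
P0 ≟ᴾ P1 = no λ ()
P0 ≟ᴾ P2 = no λ ()
P1 ≟ᴾ P0 = no λ ()
P1 ≟ᴾ P1 = yes refl
P1 ≟ᴾ P2 = no λ ()
P2 ≟ᴾ P0 = no λ ()
P2 ≟ᴾ P1 = no λ ()
P2 ≟ᴾ P2 = yes refl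

basicOf : Part → Bool → Basic
basicOf P0 false = AND
basicOf P0 true = OR
basicOf P1 _ = MAJ
basicOf P2 _ = XOR

module ModelsClosed {n : ℕ} (φ : Formula n) (part : Fin n → Part) (W : Fin n → Bool)
  (horn : PartiallyHorn part (renameFormula part W φ)) (c2 : Cond2 part φ) (c3 : Cond3 part φ) where

  open Renaming part W

  op : Fin n → Basic
  op v = basicOf (part v) (W v)

  HasV2 : Clause n → Set
  HasV2 C = ∃[ v ] v occursIn C × part v ≡ P2

  hasV2? : ∀ C → Dec (HasV2 C)
  hasV2? C with Any.any? (λ l → part (var l) ≟ᴾ P2) (disj C) | Any.any? (λ l → part (var l) ≟ᴾ P2) (par C)
  ... | yes inDisj | _ = let l , l∈ , e = find inDisj in yes (var l , (l , inj₁ l∈ , refl) , e)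
  ... | no _ | yes inPar = let l , l∈ , e = find inPar in yes (var l , (l , inj₂ l∈ , refl) , e)
  ... | no ¬inDisj | no ¬inPar = no λ { (_ , (l , inj₁ l∈ , refl) , e) → ¬inDisj (lose l∈ e)
                                     ; (_ , (l , inj₂ l∈ , refl) , e) → ¬inPar (lose l∈ e) }

  onlyV0? : ∀ C → Dec (OnlyV0 part C)
  onlyV0? C with All.all? (λ l → part (var l) ≟ᴾ P0) (disj C) | All.all? (λ l → part (var l) ≟ᴾ P0) (par C)
  ... | yes inDisj | yes inPar = yes λ { (inj₁ l∈) → All.lookup inDisj l∈ ; (inj₂ l∈) → All.lookup inPar l∈ }
  ... | no ¬inDisj | _ = no λ only → ¬inDisj (All.tabulate (only ∘ inj₁))
  ... | yes _ | no ¬inPar = no λ only → ¬inPar (All.tabulate (only ∘ inj₂))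

  hasV2⇒¬onlyV0 : ∀ {C} → HasV2 C → ¬ OnlyV0 part C
  hasV2⇒¬onlyV0 (_ , (l , l∈ , refl) , v∈V2) only with () ← trans (sym v∈V2) (only l∈)

  Positive : Literal n → Set
  Positive l = sign (renameLit part W l) ≡ true

  Negative : Literal n → Set
  Negative l = sign (renameLit part W l) ≡ false

  module _ (a b c : Vec Bool n) (a⊨φ : Model φ a) (b⊨φ : Model φ b) (c⊨φ : Model φ c) where

    y : Vec Bool n
    y = apply₃ (λ v → ⟦ op v ⟧) a b c

    data Input : Vec Bool n → Set where
      first : Input a
      second : Input b
      third : Input c

    input-model : ∀ {t} → Input t → Model φ t
    input-model first = a⊨φ
    input-model second = b⊨φ
    input-model third = c⊨φ

    evalLit-V0 : ∀ {l} → part (var l) ≡ P0 →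
      evalLit y l ≡ (if sign (renameLit part W l) then and₃ else or₃) (evalLit a l) (evalLit b l) (evalLit c l)
    evalLit-V0 {lit v s} v∈V0 rewrite evalLit-apply₃ (λ v → ⟦ op v ⟧) a b c (lit v s) | v∈V0 with W v | s
    ... | false | s = signed-and₃ s (lookup a v) (lookup b v) (lookup c v)
    ... | true | true = signed-or₃ true (lookup a v) (lookup b v) (lookup c v)
    ... | true | false = signed-or₃ false (lookup a v) (lookup b v) (lookup c v)

    evalLit-V1 : ∀ {l} → part (var l) ≡ P1 → evalLit y l ≡ maj₃ (evalLit a l) (evalLit b l) (evalLit c l)
    evalLit-V1 {l} v∈V1 rewrite evalLit-apply₃ (λ v → ⟦ op v ⟧) a b c l | v∈V1 =
      signed-maj₃ (sign l) (lookup a (var l)) (lookup b (var l)) (lookup c (var l))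

    evalLit-V2 : ∀ {l} → part (var l) ≡ P2 → evalLit y l ≡ xor₃ (evalLit a l) (evalLit b l) (evalLit c l)
    evalLit-V2 {l} v∈V2 rewrite evalLit-apply₃ (λ v → ⟦ op v ⟧) a b c l | v∈V2 =
      signed-xor₃ (sign l) (lookup a (var l)) (lookup b (var l)) (lookup c (var l))

    parity-V2 : ∀ Ls → (∀ {l} → l ∈ Ls → part (var l) ≡ P2) →
      parity (evalLits y Ls) ≡ xor₃ (parity (evalLits a Ls)) (parity (evalLits b Ls)) (parity (evalLits c Ls))
    parity-V2 [] _ = refl
    parity-V2 (l ∷ Ls) ⊆V2 =
      trans (cong₂ _xor_ (evalLit-V2 {l} (⊆V2 (here refl))) (parity-V2 Ls (⊆V2 ∘ there)))
            (xor₃-interchange (evalLit a l) (evalLit b l) (evalLit c l) _ _ _)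

    evalLit-negative : ∀ {l} → part (var l) ≡ P0 → Negative l → evalLit y l ≡ or₃ (evalLit a l) (evalLit b l) (evalLit c l)
    evalLit-negative {l} v∈V0 neg = trans (evalLit-V0 v∈V0) (cong (λ s → (if s then and₃ else or₃) _ _ _) neg)

    evalLit-positive : ∀ {l} → part (var l) ≡ P0 → Positive l → evalLit y l ≡ and₃ (evalLit a l) (evalLit b l) (evalLit c l)
    evalLit-positive {l} v∈V0 pos = trans (evalLit-V0 v∈V0) (cong (λ s → (if s then and₃ else or₃) _ _ _) pos)

    negative-false : ∀ {l t} → part (var l) ≡ P0 → Negative l → evalLit y l ≡ false → Input t → evalLit t l ≡ false
    negative-false {l} v∈V0 neg yl =
      let al , bl , cl = or₃-false (evalLit a l) (evalLit b l) (evalLit c l) (trans (sym (evalLit-negative {l} v∈V0 neg)) yl)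
      in λ { first → al ; second → bl ; third → cl }

    positive-false : ∀ {l} → part (var l) ≡ P0 → Positive l → evalLit y l ≡ false →
      ∃[ t ] Input t × evalLit t l ≡ false
    positive-false {l} v∈V0 pos yl
      with and₃-false (evalLit a l) (evalLit b l) (evalLit c l) (trans (sym (evalLit-positive {l} v∈V0 pos)) yl)
    ... | inj₁ al = a , first , al
    ... | inj₂ (inj₁ bl) = b , second , bl
    ... | inj₂ (inj₂ cl) = c , third , cl

    module _ {C : Clause n} (C∈φ : C ∈ φ) (y-falsifies : anyTrue (evalLits y (disj C)) ≡ false) where

      y-false : ∀ {l} → l ∈ disj C → evalLit y l ≡ false
      y-false = anyFalse-elim y (disj C) y-falsifies

      input-refutes : ∀ {t} → par C ≡ [] → Input t → (∀ {l} → l ∈ disj C → evalLit t l ≡ false) → ⊥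
      input-refutes {t} par≡[] input all-false
        with () ← trans (sym (sat-ordinary t {C} par≡[] (input-model input C∈φ))) (anyFalse-intro t (disj C) all-false)

      V0-negative : ¬ OnlyV0 part C → ∀ {l} → l ∈ disj C → part (var l) ≡ P0 → Negative l
      V0-negative ¬only l∈ =
        proj₂ (horn (renameFormula-∈⁺ {C = C} φ C∈φ)) (¬only ∘ onlyV0-unrename {C = C})
              (renameClause-∈⁺ {C = C} (inj₁ l∈))

      generalized-clause : HasV2 C → parity (evalLits y (par C)) ≡ true
      generalized-clause hasV2 =
        trans (parity-V2 (par C) (proj₁ (proj₂ gen)))
              (cong₃ xor₃ (input-parity first) (input-parity second) (input-parity third))
        where
        gen = proj₁ (c3 C∈φ) hasV2
        input-parity : ∀ {t} → Input t → parity (evalLits t (par C)) ≡ true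
        input-parity {t} input = trans (sym (cong (_∨ parity (evalLits t (par C))) disj-false)) (input-model input C∈φ)
          where
          disj-false : anyTrue (evalLits t (disj C)) ≡ false
          disj-false = anyFalse-intro t (disj C) λ l∈ →
            negative-false (proj₁ gen l∈) (V0-negative (hasV2⇒¬onlyV0 hasV2) l∈ (proj₁ gen l∈)) (y-false l∈) input

      -- The input falsifying the unique renamed-positive literal falsifies the whole clause.
      horn-clause : OnlyV0 part C → par C ≡ [] → ⊥
      horn-clause only par≡[] with Any.any? (λ l → sign (renameLit part W l) Bool.≟ true) (disj C)
      ... | no ¬pos = input-refutes par≡[] first λ l∈ →
        negative-false (only (inj₁ l∈)) (Bool.¬-not (¬pos ∘ lose l∈)) (y-false l∈) first
      ... | yes pos = refute (find pos)
        where
        refute : ∃[ l₀ ] l₀ ∈ disj C × Positive l₀ → ⊥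
        refute (l₀ , l₀∈ , l₀-pos) with positive-false (only (inj₁ l₀∈)) l₀-pos (y-false l₀∈)
        ... | t , input , tl₀ = input-refutes par≡[] input at-t
          where
          at-t : ∀ {l} → l ∈ disj C → evalLit t l ≡ false
          at-t {l} l∈ with sign (renameLit part W l) in s
          ... | false = negative-false (only (inj₁ l∈)) s (y-false l∈) input
          ... | true = subst (λ l′ → evalLit t l′ ≡ false) (renameLit-injective l₀≡l) tl₀
            where
            l₀≡l : renameLit part W l₀ ≡ renameLit part W l
            l₀≡l = proj₁ (horn (renameFormula-∈⁺ {C = C} φ C∈φ)) (onlyV0-rename {C = C} only)
                     (renameClause-∈⁺ {C = C} (inj₁ l₀∈)) (renameClause-∈⁺ {C = C} (inj₁ l∈)) l₀-pos s

      V1Witness : Vec Bool n → Set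
      V1Witness t = ∃[ l ] l ∈ disj C × evalLit t l ≡ true × part (var l) ≡ P1

      -- Each input satisfies the clause through a V1-literal; two of these share a variable,
      -- hence coincide, and then the majority makes that literal true at y.
      bijunctive-clause : ¬ HasV2 C → ¬ OnlyV0 part C → ⊥
      bijunctive-clause ¬hasV2 ¬only = refute (V1-witness first) (V1-witness second) (V1-witness third)
        where
        par≡[] = proj₂ (c3 C∈φ) ¬hasV2

        V1-literal : ∀ {t} → Input t → ∃[ l ] l ∈ disj C × evalLit t l ≡ true → V1Witness t
        V1-literal input (l , l∈ , tl) with part (var l) in pl
        ... | P1 = l , l∈ , tl , pl
        ... | P2 = ⊥-elim (¬hasV2 (var l , (l , inj₁ l∈ , refl) , pl))
        ... | P0 with () ← trans (sym tl) (negative-false pl (V0-negative ¬only l∈ pl) (y-false l∈) input)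

        V1-witness : ∀ {t} → Input t → V1Witness t
        V1-witness {t} input =
          V1-literal input (anyTrue-elim t (disj C) (sat-ordinary t {C} par≡[] (input-model input C∈φ)))

        majority-false : ∀ {l} → l ∈ disj C → part (var l) ≡ P1 → maj₃ (evalLit a l) (evalLit b l) (evalLit c l) ≡ false
        majority-false {l} l∈ pl = trans (sym (evalLit-V1 {l} pl)) (y-false l∈)

        occurs : ∀ {l} → l ∈ disj C → var l occursIn C
        occurs {l} l∈ = l , inj₁ l∈ , refl

        same : ∀ {l l′} → l ∈ disj C → l′ ∈ disj C → var l ≡ var l′ → l ≡ l′
        same l∈ l′∈ e = complementary-false y e (y-false l∈) (y-false l′∈)

        refute : V1Witness a → V1Witness b → V1Witness c → ⊥
        refute (la , la∈ , ala , pa) (lb , lb∈ , blb , pb) (lc , lc∈ , clc , pc)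
          with c2 C∈φ (occurs la∈) (occurs lb∈) (occurs lc∈) pa pb pc
        ... | inj₁ e with refl ← same la∈ lb∈ e =
          proj₁ (maj₃-false _ _ _ (majority-false la∈ pa)) ala blb
        ... | inj₂ (inj₁ e) with refl ← same la∈ lc∈ e =
          proj₁ (proj₂ (maj₃-false _ _ _ (majority-false la∈ pa))) ala clc
        ... | inj₂ (inj₂ e) with refl ← same lb∈ lc∈ e =
          proj₂ (proj₂ (maj₃-false _ _ _ (majority-false lb∈ pb))) blb clc

    y-model : Model φ y
    y-model {C} C∈φ with anyTrue (evalLits y (disj C)) in e₁ | parity (evalLits y (par C)) in e₂
    ... | true | _ = refl
    ... | false | true = refl
    ... | false | false with hasV2? C
    ...   | yes hasV2 with () ← trans (sym (generalized-clause C∈φ e₁ hasV2)) e₂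
    ...   | no ¬hasV2 with onlyV0? C
    ...     | yes only = ⊥-elim (horn-clause C∈φ e₁ only (proj₂ (c3 C∈φ) ¬hasV2))
    ...     | no ¬only = ⊥-elim (bijunctive-clause C∈φ e₁ ¬hasV2 ¬only)

ternaryAggregator : ∀ {n} → (Fin n → Basic) → Fin n → Vec Bool 3 → Bool
ternaryAggregator op j (x ∷ y ∷ z ∷ []) = ⟦ op j ⟧ x y z

module _ {n : ℕ} {D : Domain n} where

  basic-closure⇒lpd : ∀ {op} → Closed D (λ j → ⟦ op j ⟧) → LocalPossibilityDomain D
  basic-closure⇒lpd {op} closed =
    3 , s≤s (s≤s z≤n) , ternaryAggregator op ,
    ((λ j → ⟦⟧-idempotent (op j)) ,
     λ { (a ∷ b ∷ c ∷ []) inputs → closed a b c (inputs #0) (inputs (fs #0)) (inputs (fs (fs #0))) }) ,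
    λ j d projection → cyclic⇒¬projection (⟦⟧-cyclic (op j)) d λ x y z → projection (x ∷ y ∷ z ∷ [])

  ic⇒basic-closure : ∀ {φ} → LocalPossibilityIC φ → (∀ x → x ∈D D ⇔ Model φ x) →
    ∃[ op ] Closed D (λ j → ⟦ op j ⟧)
  ic⇒basic-closure {φ} (part , _ , (W , _ , horn) , c2 , c3) models =
    op , λ a b c aD bD cD → from (models _) (y-model a b c (to (models a) aD) (to (models b) bD) (to (models c) cD))
    where open ModelsClosed φ part W horn c2 c3

-- From a basic aggregator to an integrity constraint

partOf : Basic → Part
partOf AND = P0
partOf OR = P0
partOf MAJ = P1
partOf XOR = P2

-- ∨-coordinates are renamed, turning them into ∧-coordinates.
isRenamed : Basic → Bool
isRenamed OR = true
isRenamed _ = false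

allVectors : ∀ m → List (Vec Bool m)
allVectors zero = [] ∷ []
allVectors (suc m) = List.cartesianProductWith _∷_ (true ∷ false ∷ []) (allVectors m)

∈-allVectors : ∀ {m} (a : Vec Bool m) → a ∈ allVectors m
∈-allVectors [] = here refl
∈-allVectors (true ∷ a) = ∈-cartesianProductWith⁺ _∷_ {xs = true ∷ false ∷ []} (here refl) (∈-allVectors a)
∈-allVectors (false ∷ a) = ∈-cartesianProductWith⁺ _∷_ {xs = true ∷ false ∷ []} (there (here refl)) (∈-allVectors a)

module BasicClosure {n : ℕ} (D : Domain n) (op : Fin n → Basic) (closed : Closed D (λ j → ⟦ op j ⟧)) where

  part : Fin n → Part
  part v = partOf (op v)

  W : Fin n → Bool
  W v = isRenamed (op v)

  aggregate : Vec Bool n → Vec Bool n → Vec Bool n → Vec Bool n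
  aggregate = apply₃ (λ j → ⟦ op j ⟧)

  renamed : Vec Bool n → Fin n → Bool
  renamed a v = lookup a v xor W v

  lookup-aggregate : ∀ a b c v → lookup (aggregate a b c) v ≡ ⟦ op v ⟧ (lookup a v) (lookup b v) (lookup c v)
  lookup-aggregate a b c v = lookup∘tabulate _ v

  renamed-V0 : ∀ a b c {v} → part v ≡ P0 → renamed (aggregate a b c) v ≡ and₃ (renamed a v) (renamed b v) (renamed c v)
  renamed-V0 a b c {v} v∈V0 rewrite lookup-aggregate a b c v with op v | v∈V0
  ... | AND | _ = renamed-and₃ (lookup a v) (lookup b v) (lookup c v)
  ... | OR | _ = renamed-or₃ (lookup a v) (lookup b v) (lookup c v)

  lookup-V1 : ∀ a b c {v} → part v ≡ P1 → lookup (aggregate a b c) v ≡ maj₃ (lookup a v) (lookup b v) (lookup c v)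
  lookup-V1 a b c {v} v∈V1 rewrite lookup-aggregate a b c v with op v | v∈V1
  ... | MAJ | _ = refl

  lookup-V2 : ∀ a b c {v} → part v ≡ P2 → lookup (aggregate a b c) v ≡ xor₃ (lookup a v) (lookup b v) (lookup c v)
  lookup-V2 a b c {v} v∈V2 rewrite lookup-aggregate a b c v with op v | v∈V2
  ... | XOR | _ = refl

  AgreeOn : Part → List (Fin n) → Vec Bool n → Vec Bool n → Set
  AgreeOn p Ls c c′ = ∀ {w} → w ∈ Ls → part w ≡ p → lookup c w ≡ lookup c′ w

  agreeOn? : ∀ p Ls c c′ → Dec (AgreeOn p Ls c c′)
  agreeOn? p Ls c c′ with All.all? (λ w → (part w ≟ᴾ p) →-dec (lookup c w Bool.≟ lookup c′ w)) Ls
  ... | yes agree = yes (All.lookup agree)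
  ... | no ¬agree = no (¬agree ∘ All.tabulate)

  open Renaming part W

  P0≢P1 : ∀ {v} → part v ≡ P0 → part v ≢ P1
  P0≢P1 v∈V0 v∈V1 with () ← trans (sym v∈V0) v∈V1

  P0≢P2 : ∀ {v} → part v ≡ P0 → part v ≢ P2
  P0≢P2 v∈V0 v∈V2 with () ← trans (sym v∈V0) v∈V2

  P1≢P2 : ∀ {v} → part v ≡ P1 → part v ≢ P2
  P1≢P2 v∈V1 v∈V2 with () ← trans (sym v∈V1) v∈V2

  GoodClause : Clause n → Set
  GoodClause C =
    NoMix part (C ∷ []) × PartiallyHorn part (renameClause part W C ∷ []) × Cond2 part (C ∷ []) × Cond3 part (C ∷ [])

  module _ {C : Clause n} where

    noV1⇒noMix : (∀ {l} → l ∈L C → part (var l) ≢ P1) → NoMix part (C ∷ [])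
    noV1⇒noMix noV1 (here refl) (l , l∈ , refl) _ u∈V1 _ = noV1 l∈ u∈V1

    noV2⇒noMix : (∀ {l} → l ∈L C → part (var l) ≢ P2) → NoMix part (C ∷ [])
    noV2⇒noMix noV2 (here refl) _ (l , l∈ , refl) _ v∈V2 = noV2 l∈ v∈V2

    noV1⇒cond2 : (∀ {l} → l ∈L C → part (var l) ≢ P1) → Cond2 part (C ∷ [])
    noV1⇒cond2 noV1 (here refl) (l , l∈ , refl) _ _ u∈V1 _ _ = ⊥-elim (noV1 l∈ u∈V1)

    noV2⇒cond3 : par C ≡ [] → (∀ {l} → l ∈L C → part (var l) ≢ P2) → Cond3 part (C ∷ [])
    noV2⇒cond3 par≡[] noV2 (here refl) = (λ { (_ , (l , l∈ , refl) , v∈V2) → ⊥-elim (noV2 l∈ v∈V2) }) , λ _ → par≡[]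

    generalized⇒cond3 : GeneralizedV0V2 part C → Cond3 part (C ∷ [])
    generalized⇒cond3 gen (here refl) = (λ _ → gen) , λ ¬V2 → ⊥-elim (¬V2 (nonempty (proj₂ (proj₂ gen))))
      where
      nonempty : par C ≢ [] → ∃[ v ] v occursIn C × part v ≡ P2
      nonempty par≢[] with par C
      ... | [] = ⊥-elim (par≢[] refl)
      ... | l ∷ _ = var l , (l , inj₂ (here refl) , refl) , proj₁ (proj₂ gen) (here refl)

    partiallyHorn : (OnlyV0 part C → Horn part (renameClause part W C)) →
      (¬ OnlyV0 part C → ∀ {l} → l ∈L C → part (var l) ≡ P0 → sign (renameLit part W l) ≡ false) →
      PartiallyHorn part (renameClause part W C ∷ [])
    partiallyHorn horn mixed (here refl) =
      horn ∘ onlyV0-unrename {C = C} ,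
      λ ¬only l′∈ l′∈V0 → let l , l∈ , l′≡ = renameClause-∈⁻ {C = C} l′∈ in
        subst (λ l′ → sign l′ ≡ false) (sym l′≡)
              (mixed (¬only ∘ onlyV0-rename {C = C}) l∈ (subst (λ l′ → part (var l′) ≡ P0) l′≡ l′∈V0))

    negative⇒horn : (∀ {l} → l ∈L C → sign (renameLit part W l) ≡ false) → Horn part (renameClause part W C)
    negative⇒horn negative l′∈ _ l′-pos _ with l , l∈ , refl ← renameClause-∈⁻ {C = C} l′∈
      with () ← trans (sym (negative l∈)) l′-pos

  renamed⇒V0 : ∀ v → W v ≡ true → part v ≡ P0
  renamed⇒V0 v renamed with op v | renamed
  ... | OR | _ = refl

  good⇒ic : ∀ {ψ} → (∀ {C} → C ∈ ψ → GoodClause C) → LocalPossibilityIC ψ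
  good⇒ic {ψ} good =
    part , (λ C∈ → proj₁ (good C∈) (here refl)) , (W , renamed⇒V0 , horn) ,
    (λ C∈ → proj₁ (proj₂ (proj₂ (good C∈))) (here refl)) , (λ C∈ → proj₂ (proj₂ (proj₂ (good C∈))) (here refl))
    where
    horn : PartiallyHorn part (renameFormula part W ψ)
    horn C′∈ with C , C∈ , refl ← renameFormula-∈⁻ ψ C′∈ = proj₁ (proj₂ (good C∈)) (here refl)

  module Separation (x : Vec Bool n) where

    open ≡-Reasoning

    Above : Vec Bool n → Set
    Above d = ∀ v → part v ≡ P0 → renamed x v ≡ true → renamed d v ≡ true

    Relevant : Vec Bool n → Set
    Relevant d = d ∈D D × Above d

    relevant? : ∀ d → Dec (Relevant d)
    relevant? d = (D d Bool.≟ true) ×-dec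
      all? λ v → (part v ≟ᴾ P0) →-dec ((renamed x v Bool.≟ true) →-dec (renamed d v Bool.≟ true))

    relevant-aggregate : ∀ {a b c} → Relevant a → Relevant b → Relevant c → Relevant (aggregate a b c)
    relevant-aggregate {a} {b} {c} (aD , a-above) (bD , b-above) (cD , c-above) = closed a b c aD bD cD , above
      where
      above : Above (aggregate a b c)
      above v v∈V0 xv rewrite renamed-V0 a b c v∈V0 | a-above v v∈V0 xv | b-above v v∈V0 xv | c-above v v∈V0 xv = refl

    AgreesWith : Part → List (Fin n) → Vec Bool n → Set
    AgreesWith p Ls d = AgreeOn p Ls d x

    Agreeing : Part → List (Fin n) → Set
    Agreeing p Ls = ∃[ d ] Relevant d × AgreesWith p Ls d

    agreeing? : ∀ p Ls → Dec (Agreeing p Ls)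
    agreeing? p Ls = anySubset? λ d → relevant? d ×-dec agreeOn? p Ls d x

    agreeing-⊆ : ∀ {p Ls Ms} → (∀ {w} → w ∈ Ms → part w ≡ p → w ∈ Ls) → Agreeing p Ls → Agreeing p Ms
    agreeing-⊆ Ms⊆Ls (d , rel , agree) = d , rel , λ w∈ w∈p → agree (Ms⊆Ls w∈ w∈p) w∈p

    meet : Vec Bool n → Vec Bool n → Vec Bool n
    meet d e = aggregate (aggregate d e e) (aggregate d d e) (aggregate d d e)

    relevant-meet : ∀ {d e} → Relevant d → Relevant e → Relevant (meet d e)
    relevant-meet d-rel e-rel = relevant-aggregate (relevant-aggregate d-rel e-rel e-rel)
      (relevant-aggregate d-rel d-rel e-rel) (relevant-aggregate d-rel d-rel e-rel)

    meet-V0 : ∀ d e {v} → part v ≡ P0 → renamed (meet d e) v ≡ renamed d v ∧ renamed e v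
    meet-V0 d e {v} v∈V0 rewrite renamed-V0 (aggregate d e e) (aggregate d d e) (aggregate d d e) v∈V0
      | renamed-V0 d e e v∈V0 | renamed-V0 d d e v∈V0 = and₃-meet (renamed d v) (renamed e v)

    meet-V1 : ∀ d e {v} → part v ≡ P1 → lookup (meet d e) v ≡ lookup d v
    meet-V1 d e {v} v∈V1 rewrite lookup-V1 (aggregate d e e) (aggregate d d e) (aggregate d d e) v∈V1
      | lookup-V1 d e e v∈V1 | lookup-V1 d d e v∈V1 = maj₃-meet (lookup d v) (lookup e v)

    meet-V2 : ∀ d e {v} → part v ≡ P2 → lookup (meet d e) v ≡ lookup d v
    meet-V2 d e {v} v∈V2 rewrite lookup-V2 (aggregate d e e) (aggregate d d e) (aggregate d d e) v∈V2
      | lookup-V2 d e e v∈V2 | lookup-V2 d d e v∈V2 = xor₃-meet (lookup d v) (lookup e v)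

    Lowerable : Set
    Lowerable = ∀ v → part v ≡ P0 → renamed x v ≡ false → ∃[ e ] Relevant e × renamed e v ≡ false

    LoweredOn : List (Fin n) → Vec Bool n → Set
    LoweredOn Ls d = ∀ {v} → v ∈ Ls → part v ≡ P0 → renamed x v ≡ false → renamed d v ≡ false

    AgreesOffV0 : Vec Bool n → Set
    AgreesOffV0 d = Relevant d × AgreesWith P1 (allFin n) d × AgreesWith P2 (allFin n) d

    lower : Lowerable → ∀ {d} → AgreesOffV0 d → ∀ Ls → ∃[ d′ ] AgreesOffV0 d′ × LoweredOn Ls d′
    lower lowerable {d} agrees [] = d , agrees , λ ()
    lower lowerable agrees (l ∷ Ls) with lower lowerable agrees Ls
    ... | d , (d-rel , agree₁ , agree₂) , lowered with part l ≟ᴾ P0 | renamed x l Bool.≟ false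
    ...   | yes l∈V0 | yes xl with e , e-rel , el ← lowerable l l∈V0 xl =
      meet d e , (relevant-meet d-rel e-rel , agree₁′ , agree₂′) , lowered′
      where
      agree₁′ : AgreesWith P1 (allFin n) (meet d e)
      agree₁′ w∈ w∈V1 = trans (meet-V1 d e w∈V1) (agree₁ w∈ w∈V1)
      agree₂′ : AgreesWith P2 (allFin n) (meet d e)
      agree₂′ w∈ w∈V2 = trans (meet-V2 d e w∈V2) (agree₂ w∈ w∈V2)
      lowered′ : LoweredOn (l ∷ Ls) (meet d e)
      lowered′ (here refl) v∈V0 _ rewrite meet-V0 d e v∈V0 | el = Bool.∧-zeroʳ _
      lowered′ (there v∈) v∈V0 xv rewrite meet-V0 d e v∈V0 | lowered v∈ v∈V0 xv = refl
    ...   | yes _ | no ¬xl =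
      d , (d-rel , agree₁ , agree₂) , λ { (here refl) _ xl → ⊥-elim (¬xl xl) ; (there v∈) → lowered v∈ }
    ...   | no ¬l∈V0 | _ =
      d , (d-rel , agree₁ , agree₂) , λ { (here refl) v∈V0 → ⊥-elim (¬l∈V0 v∈V0) ; (there v∈) → lowered v∈ }

    -- Lowering all V0-coordinates of a vector that agrees with x elsewhere reaches x itself.
    lowerable⇒member : Lowerable → ∀ {d} → AgreesOffV0 d → x ∈D D
    lowerable⇒member lowerable agrees with lower lowerable agrees (allFin n)
    ... | d , ((dD , d-above) , agree₁ , agree₂) , lowered = ∈D-cong {D = D} (Pointwise-≡⇒≡ (ext d≗x)) dD
      where
      d≗x : ∀ v → lookup d v ≡ lookup x v
      d≗x v with part v in pv
      ... | P1 = agree₁ (∈-allFin v) pv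
      ... | P2 = agree₂ (∈-allFin v) pv
      ... | P0 with renamed x v in xv
      ...   | true = xor-cancelʳ _ _ (W v) (trans (d-above v pv xv) (sym xv))
      ...   | false = xor-cancelʳ _ _ (W v) (trans (lowered (∈-allFin v) pv xv) (sym xv))

    V1-pairs⇒pairs : Agreeing P1 [] → (∀ u v → part u ≡ P1 → part v ≡ P1 → Agreeing P1 (u ∷ v ∷ [])) →
      ∀ u v → Agreeing P1 (u ∷ v ∷ [])
    V1-pairs⇒pairs some V1-pairs u v with part u ≟ᴾ P1 | part v ≟ᴾ P1
    ... | yes u∈V1 | yes v∈V1 = V1-pairs u v u∈V1 v∈V1
    ... | yes u∈V1 | no v∉V1 =
      agreeing-⊆ (λ { (here refl) _ → here refl ; (there (here refl)) v∈V1 → ⊥-elim (v∉V1 v∈V1) })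
        (V1-pairs u u u∈V1 u∈V1)
    ... | no u∉V1 | yes v∈V1 =
      agreeing-⊆ (λ { (here refl) u∈V1 → ⊥-elim (u∉V1 u∈V1) ; (there (here refl)) _ → here refl })
        (V1-pairs v v v∈V1 v∈V1)
    ... | no u∉V1 | no v∉V1 =
      agreeing-⊆ (λ { (here refl) u∈V1 → ⊥-elim (u∉V1 u∈V1) ; (there (here refl)) v∈V1 → ⊥-elim (v∉V1 v∈V1) })
        some

    agreeing-off-V0 : Agreeing P1 (allFin n) → Agreeing P2 (allFin n) → ∃ AgreesOffV0
    agreeing-off-V0 (a , a-rel , a-agree) (b , b-rel , b-agree) =
      aggregate a a b , (relevant-aggregate a-rel a-rel b-rel ,
        (λ {w} w∈ w∈V1 → trans (lookup-V1 a a b w∈V1) (trans (maj₃-xxy (lookup a w) (lookup b w)) (a-agree w∈ w∈V1))) ,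
        (λ {w} w∈ w∈V2 → trans (lookup-V2 a a b w∈V2) (trans (xor₃-xxy (lookup a w) (lookup b w)) (b-agree w∈ w∈V2))))

    -- The Baker–Pixley argument for the majority operation on V1.
    pairs⇒agreeing : Agreeing P1 [] → (∀ u v → Agreeing P1 (u ∷ v ∷ [])) → Agreeing P1 (allFin n)
    pairs⇒agreeing some pairs = proj₁ (extend (allFin n))
      where
      extend : ∀ Ls → Agreeing P1 Ls × (∀ u v → Agreeing P1 (u ∷ v ∷ Ls))
      extend [] = some , pairs
      extend (l ∷ Ls) =
        agreeing-⊆ (λ { (here refl) _ → here refl ; (there w∈) _ → there (there w∈) }) (pairs′ l l) , triples
        where
        pairs′ = proj₂ (extend Ls)
        triples : ∀ u v → Agreeing P1 (u ∷ v ∷ l ∷ Ls)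
        triples u v with pairs′ u v | pairs′ l v | pairs′ l u
        ... | d₁ , r₁ , a₁ | d₂ , r₂ , a₂ | d₃ , r₃ , a₃ =
          aggregate d₁ d₂ d₃ , relevant-aggregate r₁ r₂ r₃ ,
          λ {w} w∈ w∈V1 → trans (lookup-V1 d₁ d₂ d₃ w∈V1) (maj₃-agree (agree w∈ w∈V1))
          where
          agree : ∀ {w} → w ∈ u ∷ v ∷ l ∷ Ls → part w ≡ P1 → let t = lookup x w in
            (lookup d₁ w ≡ t × lookup d₂ w ≡ t) ⊎ (lookup d₁ w ≡ t × lookup d₃ w ≡ t) ⊎
            (lookup d₂ w ≡ t × lookup d₃ w ≡ t)
          agree (here refl) w∈V1 = inj₂ (inj₁ (a₁ (here refl) w∈V1 , a₃ (there (here refl)) w∈V1))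
          agree (there (here refl)) w∈V1 = inj₁ (a₁ (there (here refl)) w∈V1 , a₂ (there (here refl)) w∈V1)
          agree (there (there (here refl))) w∈V1 = inj₂ (inj₂ (a₂ (here refl) w∈V1 , a₃ (here refl) w∈V1))
          agree (there (there (there w∈))) w∈V1 = inj₁ (a₁ (there (there w∈)) w∈V1 , a₂ (there (there w∈)) w∈V1)

    parityOn : Vec Bool n → List (Fin n) → Bool
    parityOn a T = parity (List.map (lookup a) T)

    AffineOnRelevant : (Vec Bool n → Bool) → Set
    AffineOnRelevant h = ∀ {a b c} → Relevant a → Relevant b → Relevant c → h (aggregate a b c) ≡ xor₃ (h a) (h b) (h c)

    DeterminedBy : List (Fin n) → (Vec Bool n → Bool) → Set
    DeterminedBy Ls h = ∀ {c c′} → Relevant c → Relevant c′ → AgreeOn P2 Ls c c′ → h c ≡ h c′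

    ParityOn : List (Fin n) → (Vec Bool n → Bool) → Set
    ParityOn Ls h =
      ∃[ T ] ∃[ k ] (∀ {t} → t ∈ T → t ∈ Ls × part t ≡ P2) × (∀ {c} → Relevant c → h c ≡ parityOn c T xor k)

    parityOn-weaken : ∀ {m Ls h} → ParityOn Ls h → ParityOn (m ∷ Ls) h
    parityOn-weaken (T , k , T⊆ , h≡) = T , k , (λ t∈ → there (proj₁ (T⊆ t∈)) , proj₂ (T⊆ t∈)) , h≡

    agreeOn-∷ : ∀ {p m Ls a a′} → lookup a m ≡ lookup a′ m → AgreeOn p Ls a a′ → AgreeOn p (m ∷ Ls) a a′
    agreeOn-∷ am≡ agree (here refl) _ = am≡
    agreeOn-∷ am≡ agree (there w∈) = agree w∈

    -- h ⊕ xₘ is determined by Ls, because aggregating d with a pair c, c′ that h separates flips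
    -- the m-th coordinate and h, and nothing else.
    flip-determined : ∀ {m Ls h c c′} → part m ≡ P2 → AffineOnRelevant h → DeterminedBy (m ∷ Ls) h →
      Relevant c → Relevant c′ → AgreeOn P2 Ls c c′ → h c ≢ h c′ → DeterminedBy Ls (λ a → h a xor lookup a m)
    flip-determined {m} {Ls} {h} {c} {c′} m∈V2 affine determined c-rel c′-rel agree h≢ {d} {d′} d-rel d′-rel d-agree
      with lookup d m Bool.≟ lookup d′ m
    ... | yes dm≡ = cong₂ _xor_ (determined d-rel d′-rel (agreeOn-∷ {a = d} {d′} dm≡ d-agree)) dm≡
    ... | no dm≢ = trans (sym (xor-annihilates-not (h d) (lookup d m))) (cong₂ _xor_ (sym hd′) (sym d′m))
      where
      cm≢ : lookup c m ≢ lookup c′ m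
      cm≢ cm≡ = h≢ (determined c-rel c′-rel (agreeOn-∷ {a = c} {c′} cm≡ agree))
      d′m : lookup d′ m ≡ not (lookup d m)
      d′m = ¬-not (dm≢ ∘ sym)
      e-agree : AgreeOn P2 (m ∷ Ls) (aggregate d c c′) d′
      e-agree (here refl) _ = trans (lookup-V2 d c c′ m∈V2) (trans (xor₃-distinct _ cm≢) (sym d′m))
      e-agree {w} (there w∈) w∈V2 rewrite lookup-V2 d c c′ w∈V2 | agree w∈ w∈V2 =
        trans (xor₃-xyy (lookup d w) (lookup c′ w)) (d-agree w∈ w∈V2)
      hd′ : h d′ ≡ not (h d)
      hd′ = trans (sym (determined (relevant-aggregate d-rel c-rel c′-rel) d′-rel e-agree))
                  (trans (affine d-rel c-rel c′-rel) (xor₃-distinct (h d) h≢))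

    -- Induction on Ls: either h is already determined by the rest of Ls, or h ⊕ xₘ is.
    affine⇒parity : ∀ {d₀} → Relevant d₀ → ∀ Ls {h} → AffineOnRelevant h → DeterminedBy Ls h → ParityOn Ls h
    affine⇒parity {d₀} d₀-rel [] {h} _ determined = [] , h d₀ , (λ ()) , λ c-rel → determined c-rel d₀-rel (λ ())
    affine⇒parity d₀-rel (m ∷ Ls) {h} affine determined with part m ≟ᴾ P2
    ... | no m∉V2 = parityOn-weaken (affine⇒parity d₀-rel Ls affine λ c-rel c′-rel agree →
          determined c-rel c′-rel λ { (here refl) m∈V2 → ⊥-elim (m∉V2 m∈V2) ; (there w∈) → agree w∈ })
    ... | yes m∈V2
      with anySubset? (λ c → anySubset? λ c′ →
             relevant? c ×-dec relevant? c′ ×-dec agreeOn? P2 Ls c c′ ×-dec ¬? (h c Bool.≟ h c′))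
    ...   | no none = parityOn-weaken (affine⇒parity d₀-rel Ls affine λ {c} {c′} c-rel c′-rel agree →
            decidable-stable (h c Bool.≟ h c′) λ h≢ → none (c , c′ , c-rel , c′-rel , agree , h≢))
    ...   | yes (c , c′ , c-rel , c′-rel , agree , h≢) =
            let T , k , T⊆ , h′≡ =
                  affine⇒parity d₀-rel Ls {h′} affine′ (flip-determined m∈V2 affine determined c-rel c′-rel agree h≢)
            in m ∷ T , k ,
               (λ { (here refl) → here refl , m∈V2 ; (there t∈) → there (proj₁ (T⊆ t∈)) , proj₂ (T⊆ t∈) }) ,
               λ {d} d-rel → xor-solve (h d) (lookup d m) (parityOn d T) k (h′≡ d-rel)
      where
      h′ : Vec Bool n → Bool
      h′ a = h a xor lookup a m
      affine′ : AffineOnRelevant h′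
      affine′ {a} {b} {c} a-rel b-rel c-rel rewrite affine a-rel b-rel c-rel | lookup-V2 a b c m∈V2 =
        xor₃-interchange (h a) (h b) (h c) (lookup a m) (lookup b m) (lookup c m)

    parityOn-agree : ∀ {b Ls} T → (∀ {t} → t ∈ T → t ∈ Ls × part t ≡ P2) → AgreesWith P2 Ls b →
      parityOn b T ≡ parityOn x T
    parityOn-agree [] _ _ = refl
    parityOn-agree {b} (t ∷ T) T⊆ agree =
      cong₂ _xor_ (agree (proj₁ (T⊆ (here refl))) (proj₂ (T⊆ (here refl)))) (parityOn-agree {b} T (T⊆ ∘ there) agree)

    Separating : List (Fin n) → Set
    Separating T = (∀ {t} → t ∈ T → part t ≡ P2) × (∀ {d} → Relevant d → parityOn d T ≢ parityOn x T)

    -- Coordinate l is affine and, as no relevant vector agrees with x on l ∷ Ls, determined by Ls;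
    -- so it is a parity on relevant vectors, which x violates.
    separating-parity : ∀ {d₀ b l Ls} → Relevant d₀ → part l ≡ P2 → Relevant b → AgreesWith P2 Ls b →
      ¬ Agreeing P2 (l ∷ Ls) → ∃[ T ] Separating (l ∷ T)
    separating-parity {b = b} {l} {Ls} d₀-rel l∈V2 b-rel b-agree ¬agreeing =
      separate (affine⇒parity d₀-rel Ls {λ c → lookup c l} (λ {a} {b} {c} _ _ _ → lookup-V2 a b c l∈V2) determined)
      where
      xl≡ : lookup x l ≡ not (lookup b l)
      xl≡ = ¬-not λ xl≡bl → ¬agreeing (b , b-rel , agreeOn-∷ {a = b} {x} (sym xl≡bl) b-agree)

      determined : DeterminedBy Ls (λ c → lookup c l)
      determined {c} {c′} c-rel c′-rel agree = decidable-stable (lookup c l Bool.≟ lookup c′ l) λ cl≢ →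
        ¬agreeing (aggregate b c c′ , relevant-aggregate b-rel c-rel c′-rel , λ
          { (here refl) _ → trans (lookup-V2 b c c′ l∈V2) (trans (xor₃-distinct _ cl≢) (sym xl≡))
          ; {w} (there w∈) w∈V2 → trans (lookup-V2 b c c′ w∈V2)
              (trans (cong (xor₃ (lookup b w) (lookup c w)) (sym (agree w∈ w∈V2)))
                     (trans (xor₃-xyy (lookup b w) (lookup c w)) (b-agree w∈ w∈V2))) })

      separate : ParityOn Ls (λ c → lookup c l) → ∃[ T ] Separating (l ∷ T)
      separate (T , k , T⊆ , d-parity) =
        T , (λ { (here refl) → l∈V2 ; (there t∈) → proj₂ (T⊆ t∈) }) ,
        λ d-rel d≡x → not-¬ refl (trans (sym (relevant-parity d-rel)) (trans d≡x x-parity))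
        where
        relevant-parity : ∀ {d} → Relevant d → parityOn d (l ∷ T) ≡ k
        relevant-parity {d} d-rel = trans (cong (_xor parityOn d T) (d-parity d-rel)) (xor-cancel-left (parityOn d T) k)
        x-parity : parityOn x (l ∷ T) ≡ not k
        x-parity = begin
          lookup x l xor parityOn x T       ≡⟨ cong₂ _xor_ xl≡ (sym (parityOn-agree {b} T T⊆ b-agree)) ⟩
          not (lookup b l) xor parityOn b T ≡⟨ sym (Bool.not-distribˡ-xor (lookup b l) (parityOn b T)) ⟩
          not (parityOn b (l ∷ T))          ≡⟨ cong not (relevant-parity b-rel) ⟩
          not k                             ∎

    agreeing-or-separating : ∀ {d₀} → Relevant d₀ → ∀ Ls → Agreeing P2 Ls ⊎ ∃[ t ] ∃[ T ] Separating (t ∷ T)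
    agreeing-or-separating d₀-rel [] = inj₁ (_ , d₀-rel , λ ())
    agreeing-or-separating d₀-rel (l ∷ Ls) with agreeing-or-separating d₀-rel Ls
    ... | inj₂ separating = inj₂ separating
    ... | inj₁ (b , b-rel , b-agree) with part l ≟ᴾ P2 | agreeing? P2 (l ∷ Ls)
    ...   | _ | yes agreeing = inj₁ agreeing
    ...   | yes l∈V2 | no ¬agreeing = inj₂ (l , separating-parity d₀-rel l∈V2 b-rel b-agree ¬agreeing)
    ...   | no l∉V2 | no ¬agreeing =
      ⊥-elim (¬agreeing (b , b-rel , λ { (here refl) l∈V2 → ⊥-elim (l∉V2 l∈V2) ; (there w∈) → b-agree w∈ }))


    against : Fin n → Literal n
    against v = lit v (not (lookup x v))

    against-x : ∀ v → evalLit x (against v) ≡ false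
    against-x v with lookup x v
    ... | true = refl
    ... | false = refl

    against-other : ∀ {d v} → lookup d v ≢ lookup x v → evalLit d (against v) ≡ true
    against-other {d} {v} d≢x with lookup d v | lookup x v
    ... | true | true = ⊥-elim (d≢x refl)
    ... | true | false = refl
    ... | false | true = refl
    ... | false | false = ⊥-elim (d≢x refl)

    against-sign : ∀ v → sign (renameLit part W (against v)) ≡ not (renamed x v)
    against-sign v with W v | lookup x v
    ... | true | true = refl
    ... | true | false = refl
    ... | false | true = refl
    ... | false | false = refl

    above-x? : ∀ v → Dec (part v ≡ P0 × renamed x v ≡ true)
    above-x? v = (part v ≟ᴾ P0) ×-dec (renamed x v Bool.≟ true)

    aboveVars : List (Fin n)
    aboveVars = List.filter above-x? (allFin n)

    -- Every clause below contains these literals, so only vectors above x need to be separated from x.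
    base : List (Literal n)
    base = List.map against aboveVars

    base-literal : ∀ {l} → l ∈ base → part (var l) ≡ P0 × sign (renameLit part W l) ≡ false × evalLit x l ≡ false
    base-literal l∈ with v , v∈ , refl ← ∈-map⁻ against l∈
                    with _ , v∈V0 , xv ← ∈-filter⁻ above-x? {xs = allFin n} v∈ =
      v∈V0 , trans (against-sign v) (cong not xv) , against-x v

    base-or-above : ∀ d → anyTrue (evalLits d base) ≡ true ⊎ Above d
    base-or-above d with any? (λ v → (part v ≟ᴾ P0) ×-dec (renamed x v Bool.≟ true) ×-dec (renamed d v Bool.≟ false))
    ... | yes (v , v∈V0 , xv , dv) =
      inj₁ (anyTrue-intro d base (∈-map⁺ against (∈-filter⁺ above-x? (∈-allFin v) (v∈V0 , xv))) (against-other {d} dv≢xv))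
      where
      dv≢xv : lookup d v ≢ lookup x v
      dv≢xv dv≡xv = not-¬ refl (trans (sym dv) (trans (cong (_xor W v) dv≡xv) xv))
    ... | no none = inj₂ λ v v∈V0 xv → decidable-stable (renamed d v Bool.≟ true) λ dv → none (v , v∈V0 , xv , ¬-not dv)

    withBase : List (Literal n) → List (Literal n) → Clause n
    withBase E P = clause (E ++ base) P

    withBase-literal : ∀ {E P l} → l ∈L withBase E P → l ∈ E ⊎ l ∈ base ⊎ l ∈ P
    withBase-literal {E} (inj₁ l∈) with ∈-++⁻ E l∈
    ... | inj₁ l∈E = inj₁ l∈E
    ... | inj₂ l∈base = inj₂ (inj₁ l∈base)
    withBase-literal (inj₂ l∈P) = inj₂ (inj₂ l∈P)

    Separator : Set
    Separator = Σ (Clause n) λ C → GoodClause C × (∀ d → d ∈D D → SatClause d C) × ¬ SatClause x C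

    separator : ∀ E P → GoodClause (withBase E P) → (∀ {l} → l ∈ E → evalLit x l ≡ false) →
      parity (evalLits x P) ≡ false → (∀ {d} → Relevant d → SatClause d (withBase E P)) → Separator
    separator E P good x-E x-P relevant-sat =
      withBase E P , good , sat , unsat x {withBase E P} (anyFalse-intro x (E ++ base) x-false) x-P
      where
      sat : ∀ d → d ∈D D → SatClause d (withBase E P)
      sat d dD with base-or-above d
      ... | inj₂ above = relevant-sat (dD , above)
      ... | inj₁ base-true with l , l∈ , dl ← anyTrue-elim d base base-true =
        sat-by-literal d {withBase E P} (∈-++⁺ʳ E l∈) dl
      x-false : ∀ {l} → l ∈ E ++ base → evalLit x l ≡ false
      x-false l∈ with ∈-++⁻ E l∈
      ... | inj₁ l∈E = x-E l∈E
      ... | inj₂ l∈base = proj₂ (proj₂ (base-literal l∈base))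

    base-V0 : ∀ {l} → l ∈ base → part (var l) ≡ P0
    base-V0 = proj₁ ∘ base-literal

    base-negative : ∀ {l} → l ∈ base → sign (renameLit part W l) ≡ false
    base-negative = proj₁ ∘ proj₂ ∘ base-literal

    no-relevant : ¬ (∃ Relevant) → Separator
    no-relevant none = separator [] [] good (λ ()) refl λ d-rel → ⊥-elim (none (_ , d-rel))
      where
      in-base : ∀ {l} → l ∈L withBase [] [] → l ∈ base
      in-base (inj₁ l∈) = l∈
      negative : ∀ {l} → l ∈L withBase [] [] → sign (renameLit part W l) ≡ false
      negative = base-negative ∘ in-base
      good : GoodClause (withBase [] [])
      good = noV1⇒noMix (P0≢P1 ∘ base-V0 ∘ in-base) ,
             partiallyHorn (λ _ → negative⇒horn negative) (λ _ l∈ _ → negative l∈) ,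
             noV1⇒cond2 (P0≢P1 ∘ base-V0 ∘ in-base) ,
             noV2⇒cond3 refl (P0≢P2 ∘ base-V0 ∘ in-base)

    renamed-differs : ∀ {d v} → renamed d v ≡ true → renamed x v ≡ false → lookup d v ≢ lookup x v
    renamed-differs {v = v} dv xv dv≡xv with () ← trans (sym dv) (trans (cong (_xor W v) dv≡xv) xv)

    lowered-coordinate : ∀ v → part v ≡ P0 → renamed x v ≡ false → (∀ {d} → Relevant d → renamed d v ≡ true) →
      Separator
    lowered-coordinate v v∈V0 xv forced =
      separator (against v ∷ []) [] good (λ { (here refl) → against-x v }) refl
        λ {d} d-rel → sat-by-literal d {C} (here refl) (against-other {d} (renamed-differs {d} (forced d-rel) xv))
      where
      C = withBase (against v ∷ []) []
      literal : ∀ {l} → l ∈L C → l ≡ against v ⊎ l ∈ base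
      literal l∈ with withBase-literal {against v ∷ []} {[]} l∈
      ... | inj₁ (here e) = inj₁ e
      ... | inj₂ (inj₁ l∈base) = inj₂ l∈base
      only : OnlyV0 part C
      only l∈ with literal l∈
      ... | inj₁ refl = v∈V0
      ... | inj₂ l∈base = base-V0 l∈base
      positive : ∀ {l} → l ∈L C → sign (renameLit part W l) ≡ true → l ≡ against v
      positive l∈ pos with literal l∈
      ... | inj₁ e = e
      ... | inj₂ l∈base with () ← trans (sym (base-negative l∈base)) pos
      horn : Horn part (renameClause part W C)
      horn l₁∈ l₂∈ pos₁ pos₂ with renameClause-∈⁻ {C = C} l₁∈ | renameClause-∈⁻ {C = C} l₂∈
      ... | l₁ , l₁∈′ , refl | l₂ , l₂∈′ , refl =
        cong (renameLit part W) (trans (positive l₁∈′ pos₁) (sym (positive l₂∈′ pos₂)))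
      good : GoodClause C
      good = noV1⇒noMix (P0≢P1 ∘ only) , partiallyHorn (λ _ → horn) (λ ¬only → ⊥-elim (¬only only)) ,
             noV1⇒cond2 (P0≢P1 ∘ only) , noV2⇒cond3 refl (P0≢P2 ∘ only)

    unagreeing-pair : ∀ u v → part u ≡ P1 → part v ≡ P1 → ¬ Agreeing P1 (u ∷ v ∷ []) → Separator
    unagreeing-pair u v u∈V1 v∈V1 ¬agreeing =
      separator (against u ∷ against v ∷ []) [] good
        (λ { (here refl) → against-x u ; (there (here refl)) → against-x v }) refl sat
      where
      C = withBase (against u ∷ against v ∷ []) []
      literal : ∀ {l} → l ∈L C → l ≡ against u ⊎ l ≡ against v ⊎ l ∈ base
      literal l∈ with withBase-literal {against u ∷ against v ∷ []} {[]} l∈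
      ... | inj₁ (here e) = inj₁ e
      ... | inj₁ (there (here e)) = inj₂ (inj₁ e)
      ... | inj₂ (inj₁ l∈base) = inj₂ (inj₂ l∈base)
      noV2 : ∀ {l} → l ∈L C → part (var l) ≢ P2
      noV2 l∈ with literal l∈
      ... | inj₁ refl = P1≢P2 u∈V1
      ... | inj₂ (inj₁ refl) = P1≢P2 v∈V1
      ... | inj₂ (inj₂ l∈base) = P0≢P2 (base-V0 l∈base)
      V0-negative : ∀ {l} → l ∈L C → part (var l) ≡ P0 → sign (renameLit part W l) ≡ false
      V0-negative l∈ l∈V0 with literal l∈
      ... | inj₁ refl = ⊥-elim (P0≢P1 l∈V0 u∈V1)
      ... | inj₂ (inj₁ refl) = ⊥-elim (P0≢P1 l∈V0 v∈V1)
      ... | inj₂ (inj₂ l∈base) = base-negative l∈base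
      V1-vars : ∀ {w} → w occursIn C → part w ≡ P1 → w ≡ u ⊎ w ≡ v
      V1-vars (l , l∈ , refl) w∈V1 with literal l∈
      ... | inj₁ refl = inj₁ refl
      ... | inj₂ (inj₁ refl) = inj₂ refl
      ... | inj₂ (inj₂ l∈base) = ⊥-elim (P0≢P1 (base-V0 l∈base) w∈V1)
      good : GoodClause C
      good = noV2⇒noMix noV2 ,
             partiallyHorn (λ only → ⊥-elim (P0≢P1 (only (inj₁ (here refl))) u∈V1)) (λ _ → V0-negative) ,
             (λ { (here refl) o₁ o₂ o₃ p₁ p₂ p₃ →
                    pigeonhole (V1-vars o₁ p₁) (V1-vars o₂ p₂) (V1-vars o₃ p₃) }) ,
             noV2⇒cond3 refl noV2
      sat : ∀ {d} → Relevant d → SatClause d C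
      sat {d} d-rel with lookup d u Bool.≟ lookup x u | lookup d v Bool.≟ lookup x v
      ... | no du≢ | _ = sat-by-literal d {C} (here refl) (against-other {d} du≢)
      ... | yes _ | no dv≢ = sat-by-literal d {C} (there (here refl)) (against-other {d} dv≢)
      ... | yes du≡ | yes dv≡ = ⊥-elim (¬agreeing (d , d-rel , λ { (here refl) _ → du≡ ; (there (here refl)) _ → dv≡ }))

    parityLits : Fin n → List (Fin n) → Bool → List (Literal n)
    parityLits t T c = lit t (not c) ∷ List.map (λ s → lit s true) T

    parityLits-var : ∀ {t T c l} → l ∈ parityLits t T c → var l ∈ t ∷ T
    parityLits-var (here refl) = here refl
    parityLits-var {T = T} (there l∈) with s , s∈ , refl ← ∈-map⁻ (λ s → lit s true) {xs = T} l∈ = there s∈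

    parity-parityLits : ∀ a t T c → parity (evalLits a (parityLits t T c)) ≡ parityOn a (t ∷ T) xor c
    parity-parityLits a t T c rewrite evalLits-positive a T = signed-not-xor c (lookup a t) (parityOn a T)

    separating-parity-clause : ∀ t T → Separating (t ∷ T) → Separator
    separating-parity-clause t T (⊆V2 , separates) =
      separator [] P good (λ ()) (trans (parity-parityLits x t T c) (xor-same c))
        λ {d} d-rel → sat-by-parity d {C} (trans (parity-parityLits d t T c) (≢⇒xor-true (separates d-rel)))
      where
      c = parityOn x (t ∷ T)
      P = parityLits t T c
      C = withBase [] P
      P-V2 : ∀ {l} → l ∈ P → part (var l) ≡ P2
      P-V2 = ⊆V2 ∘ parityLits-var
      literal : ∀ {l} → l ∈L C → l ∈ base ⊎ l ∈ P
      literal l∈ with withBase-literal {[]} {P} l∈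
      ... | inj₂ (inj₁ l∈base) = inj₁ l∈base
      ... | inj₂ (inj₂ l∈P) = inj₂ l∈P
      noV1 : ∀ {l} → l ∈L C → part (var l) ≢ P1
      noV1 l∈ l∈V1 with literal l∈
      ... | inj₁ l∈base = P0≢P1 (base-V0 l∈base) l∈V1
      ... | inj₂ l∈P = P1≢P2 l∈V1 (P-V2 l∈P)
      V0-negative : ∀ {l} → l ∈L C → part (var l) ≡ P0 → sign (renameLit part W l) ≡ false
      V0-negative l∈ l∈V0 with literal l∈
      ... | inj₁ l∈base = base-negative l∈base
      ... | inj₂ l∈P = ⊥-elim (P0≢P2 l∈V0 (P-V2 l∈P))
      good : GoodClause C
      good = noV1⇒noMix noV1 ,
             partiallyHorn (λ only → ⊥-elim (P0≢P2 (only (inj₂ (here refl))) (P-V2 (here refl)))) (λ _ → V0-negative) ,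
             noV1⇒cond2 noV1 ,
             generalized⇒cond3 (base-V0 , P-V2 , λ ())

    lowerable-separator : ¬ x ∈D D → ∀ {d₀} → Relevant d₀ → Lowerable → Separator
    lowerable-separator x∉D {d₀} d₀-rel lowerable
      with any? (λ u → any? λ v → (part u ≟ᴾ P1) ×-dec (part v ≟ᴾ P1) ×-dec ¬? (agreeing? P1 (u ∷ v ∷ [])))
    ... | yes (u , v , u∈V1 , v∈V1 , ¬agreeing) = unagreeing-pair u v u∈V1 v∈V1 ¬agreeing
    ... | no ¬unagreeing with agreeing-or-separating d₀-rel (allFin n)
    ...   | inj₂ (t , T , separating) = separating-parity-clause t T separating
    ...   | inj₁ agreeing₂ = ⊥-elim (x∉D (lowerable⇒member lowerable (proj₂ (agreeing-off-V0 agreeing₁ agreeing₂))))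
      where
      agreeing₁ : Agreeing P1 (allFin n)
      agreeing₁ = pairs⇒agreeing (d₀ , d₀-rel , λ ()) (V1-pairs⇒pairs (d₀ , d₀-rel , λ ()) λ u v u∈V1 v∈V1 →
        decidable-stable (agreeing? P1 (u ∷ v ∷ [])) λ ¬agreeing → ¬unagreeing (u , v , u∈V1 , v∈V1 , ¬agreeing))

    separate : ¬ x ∈D D → Separator
    separate x∉D with anySubset? relevant?
    ... | no none = no-relevant none
    ... | yes (d₀ , d₀-rel)
      with any? (λ v → (part v ≟ᴾ P0) ×-dec (renamed x v Bool.≟ false) ×-dec
                       ∀-Vec-Bool? λ d → relevant? d →-dec (renamed d v Bool.≟ true))
    ...   | yes (v , v∈V0 , xv , forced) = lowered-coordinate v v∈V0 xv (forced _)
    ...   | no ¬forced = lowerable-separator x∉D d₀-rel λ v v∈V0 xv →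
      decidable-stable (anySubset? λ e → relevant? e ×-dec (renamed e v Bool.≟ false)) λ none →
        ¬forced (v , v∈V0 , xv , λ d d-rel → decidable-stable (renamed d v Bool.≟ true) λ dv → none (d , d-rel , ¬-not dv))

  separatingClauses : Vec Bool n → List (Clause n)
  separatingClauses x with D x Bool.≟ true
  ... | yes _ = []
  ... | no x∉D = proj₁ (Separation.separate x x∉D) ∷ []

  separatingClauses-good : ∀ x {C} → C ∈ separatingClauses x → GoodClause C × (∀ d → d ∈D D → SatClause d C)
  separatingClauses-good x C∈ with D x Bool.≟ true
  separatingClauses-good x (here refl) | no x∉D = let _ , good , sat , _ = Separation.separate x x∉D in good , sat

  separatingClauses-refute : ∀ x → ¬ x ∈D D → ∃[ C ] C ∈ separatingClauses x × ¬ SatClause x C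
  separatingClauses-refute x x∉D with D x Bool.≟ true
  ... | yes x∈D = ⊥-elim (x∉D x∈D)
  ... | no x∉D = let C , _ , _ , x⊭C = Separation.separate x x∉D in C , here refl , x⊭C

  φ : Formula n
  φ = List.concatMap separatingClauses (allVectors n)

  φ-good : ∀ {C} → C ∈ φ → GoodClause C × (∀ d → d ∈D D → SatClause d C)
  φ-good C∈ with x , C∈x ← Any.satisfied (∈-concatMap⁻ separatingClauses {xs = allVectors n} C∈) =
    separatingClauses-good x C∈x

  φ-models : ∀ x → x ∈D D ⇔ Model φ x
  φ-models x = mk⇔ (λ x∈D {C} C∈ → proj₂ (φ-good C∈) x x∈D) model⇒member
    where
    model⇒member : Model φ x → x ∈D D
    model⇒member x⊨φ = decidable-stable (D x Bool.≟ true) λ x∉D →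
      let C , C∈ , x⊭C = separatingClauses-refute x x∉D
      in x⊭C (x⊨φ (∈-concatMap⁺ separatingClauses (lose (∈-allVectors x) C∈)))

  basic-closure⇒ic : Σ (Formula n) λ ψ → LocalPossibilityIC ψ × (∀ x → x ∈D D ⇔ Model ψ x)
  basic-closure⇒ic = φ , good⇒ic (proj₁ ∘ φ-good) , φ-models

theorem4p7 : (n : ℕ) (D : Domain n) → NonDegenerate D →
    LocalPossibilityDomain D ⇔
      Σ (Formula n) (λ φ → LocalPossibilityIC φ × ((x : Vec Bool n) → (x ∈D D ⇔ Model φ x)))
theorem4p7 n D _ = mk⇔
  (λ { (_ , _ , _ , aggregator , lnd) →
         let op , closed = aggregator⇒basic-closure aggregator lnd in BasicClosure.basic-closure⇒ic D op closed })
  (λ (φ , ic , models) → let op , closed = ic⇒basic-closure ic models in basic-closure⇒lpd {op = op} closed)
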